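{- Let $5 \le p \le q$ and let $D$ be a strong orientation of $K(3,p,q)$ with diameter two, with parts $V_1=\{x_1,x_2,x_3\}$, $V_2$ ($|V_2|=p$), $V_3$ ($|V_3|=q$). If exactly two of the eight sets $V_2^A$ ($A \subseteq \{1,2,3\}$) are nonempty, then $q \le \binom{p+1}{\lfloor \frac{p+1}{2} \rfloor} - 1$.
   Context: $K(3,p,q)$ is the complete tripartite graph with parts $V_1=\{x_1,x_2,x_3\}$, $V_2$ of size $p$, $V_3$ of size $q$. A strong orientation is an orientation of all edges making the digraph strongly connected; its diameter is the maximum directed distance between ordered pairs of vertices. Write $u\to v$ if the edge $uv$ is oriented from $u$ to $v$. For $A \subseteq [3]=\{1,2,3\}$, let $N_D^A$ be the set of vertices $w$ such that $x_i \to w$ for all $i \in A$ and $w \to x_j$ for all $j \in [3]\setminus A$, and $V_2^A = V_2 \cap N_D^A$. The eight sets $V_2^A$ partition $V_2$. -}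

module Defs where

open import Data.Nat using (ℕ)
open import Data.Fin using (Fin)
import Data.Fin
open import Data.Sum using (_⊎_; inj₁; inj₂)
open import Data.Product using (Σ; _×_; ∃; ∃-syntax)
open import Data.Bool using (Bool; true; false)
open import Data.Vec using (Vec; lookup)
open import Data.Fin.Subset using (Subset; _∈_; _∉_)
open import Relation.Binary.PropositionalEquality using (_≡_; _≢_)
open import Relation.Nullary using (¬_)

Vertex : ℕ → ℕ → Set
Vertex p q = Fin 3 ⊎ (Fin p ⊎ Fin q)

part : ∀ {p q} → Vertex p q → Fin 3
part (inj₁ _)        = Data.Fin.zero
part (inj₂ (inj₁ _)) = Data.Fin.suc Data.Fin.zero
part (inj₂ (inj₂ _)) = Data.Fin.suc (Data.Fin.suc Data.Fin.zero)

x : ∀ {p q} → Fin 3 → Vertex p q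
x i = inj₁ i

v₂ : ∀ {p q} → Fin p → Vertex p q
v₂ v = inj₂ (inj₁ v)

Digraph : ℕ → ℕ → Set
Digraph p q = Vertex p q → Vertex p q → Bool

IsOrientation : ∀ {p q} → Digraph p q → Set
IsOrientation {p} {q} D =
  (∀ (u v : Vertex p q) → part u ≡ part v → D u v ≡ false) ×
  (∀ (u v : Vertex p q) → part u ≢ part v →
     (D u v ≡ true × D v u ≡ false) ⊎ (D u v ≡ false × D v u ≡ true))

DistLe2 : ∀ {p q} → Digraph p q → Vertex p q → Vertex p q → Set
DistLe2 D u v = D u v ≡ true ⊎ (∃[ w ] (D u w ≡ true × D w v ≡ true))

data Reach {p q} (D : Digraph p q) : Vertex p q → Vertex p q → Set where
  here : ∀ {u} → Reach D u u
  step : ∀ {u w v} → D u w ≡ true → Reach D w v → Reach D u v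

IsStrong : ∀ {p q} → Digraph p q → Set
IsStrong {p} {q} D = ∀ (u v : Vertex p q) → Reach D u v

HasDiameterTwo : ∀ {p q} → Digraph p q → Set
HasDiameterTwo {p} {q} D =
  (∀ (u v : Vertex p q) → u ≢ v → DistLe2 D u v) ×
  (∃[ u ] ∃[ v ] (u ≢ v × ¬ (D u v ≡ true)))

InN : ∀ {p q} → Digraph p q → Subset 3 → Vertex p q → Set
InN D A w = ∀ (i : Fin 3) → (i ∈ A → D (x i) w ≡ true) × (i ∉ A → D w (x i) ≡ true)

V2Nonempty : ∀ {p q} → Digraph p q → Subset 3 → Set
V2Nonempty {p} D A = ∃[ v ] InN D A (v₂ {p} v)

ExactlyTwoV2Nonempty : ∀ {p q} → Digraph p q → Set
ExactlyTwoV2Nonempty D =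
  ∃[ A ] ∃[ B ] (A ≢ B × V2Nonempty D A × V2Nonempty D B ×
     (∀ C → V2Nonempty D C → C ≡ A ⊎ C ≡ B))

{-# OPTIONS --safe #-}
module Submission where

open import Defs
open import Data.Nat using (ℕ; _≤_; _∸_; _/_; _+_)
open import Data.Nat.Combinatorics using (_C_)
open import Data.Nat using (suc; s≤s; z≤n)
open import Data.Nat.Properties using (+-comm; ≤-trans; ∸-monoˡ-≤)
open import Relation.Binary.PropositionalEquality using (subst)

module Central where
  open import Data.Nat
  open import Data.Nat.Properties
  open import Data.Nat.Combinatorics using (_C_; nCk+nC[k+1]≡[n+1]C[k+1]; nCk≡nC[n∸k]; nCk≡n!/k![n-k]!; k![n∸k]!∣n!)
  open import Data.Nat.DivMod using (m/n*n≡m; _/_; m/n≡1+[m∸n]/n)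
  open import Data.Product using (_×_; _,_; ∃-syntax)
  open import Data.Sum using (inj₁; inj₂)
  open import Relation.Binary.PropositionalEquality
  open import Relation.Nullary using (yes; no)

  binomial-identity : ∀ {n k} → k ≤ n → (n C k) * (k ! * (n ∸ k) !) ≡ n !
  binomial-identity {n} {k} k≤n = begin
    (n C k) * (k ! * (n ∸ k) !)                      ≡⟨ cong (_* (k ! * (n ∸ k) !)) (nCk≡n!/k![n-k]! k≤n) ⟩
    (n ! / (k ! * (n ∸ k) !)) * (k ! * (n ∸ k) !)   ≡⟨ m/n*n≡m (k![n∸k]!∣n! k≤n) ⟩
    n !                                              ∎
    where
    open ≡-Reasoning
    instance _ = k !* (n ∸ k) !≢0

  C-positive : ∀ {n k} → k ≤ n → 1 ≤ n C k
  C-positive {n} {k} k≤n with n C k in nCk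
  ... | suc _ = s≤s z≤n
  ... | zero = contradiction′ (trans (sym (binomial-identity k≤n)) (cong (_* (k ! * (n ∸ k) !)) nCk))
    where
    contradiction′ : n ! ≡ 0 → 1 ≤ 0
    contradiction′ n!≡0 = subst (1 ≤_) n!≡0 (1≤n! n)

  central : ℕ → ℕ
  central n = n C ⌊ n /2⌋

  n∸⌊n/2⌋≡⌈n/2⌉ : ∀ n → n ∸ ⌊ n /2⌋ ≡ ⌈ n /2⌉
  n∸⌊n/2⌋≡⌈n/2⌉ n = trans (cong (_∸ ⌊ n /2⌋) (sym (⌊n/2⌋+⌈n/2⌉≡n n))) (m+n∸m≡n ⌊ n /2⌋ ⌈ n /2⌉)

  central-recurrence : ∀ n j → ⌊ n /2⌋ ≡ suc j → central (2 + n) ≡ (n C j + central n) + central (1 + n)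
  central-recurrence n j ⌊n/2⌋≡1+j = begin
    central (2 + n)                                ≡⟨ nCk+nC[k+1]≡[n+1]C[k+1] (1 + n) ⌊ n /2⌋ ⟨
    (1 + n) C ⌊ n /2⌋ + (1 + n) C suc ⌊ n /2⌋     ≡⟨ cong₂ _+_ lower upper ⟩
    (n C j + central n) + central (1 + n)          ∎
    where
    open ≡-Reasoning
    lower : (1 + n) C ⌊ n /2⌋ ≡ n C j + central n
    lower = begin
      (1 + n) C ⌊ n /2⌋   ≡⟨ cong ((1 + n) C_) ⌊n/2⌋≡1+j ⟩
      (1 + n) C suc j      ≡⟨ nCk+nC[k+1]≡[n+1]C[k+1] n j ⟨
      n C j + n C suc j    ≡⟨ cong (λ k → n C j + n C k) ⌊n/2⌋≡1+j ⟨
      n C j + central n    ∎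
    upper : (1 + n) C suc ⌊ n /2⌋ ≡ central (1 + n)
    upper = trans (nCk≡nC[n∸k] (s≤s (⌊n/2⌋≤n n))) (cong ((1 + n) C_) (n∸⌊n/2⌋≡⌈n/2⌉ n))

  central-grows : ∀ n → 2 ≤ n → central n + central (1 + n) + 1 ≤ central (2 + n)
  central-grows n@(suc (suc m)) (s≤s (s≤s z≤n)) = begin
    central n + central (1 + n) + 1    ≡⟨ +-comm _ 1 ⟩
    1 + (central n + central (1 + n))  ≤⟨ +-monoˡ-≤ _ (C-positive (≤-trans (⌊n/2⌋≤n m) (m≤n+m m 2))) ⟩
    n C ⌊ m /2⌋ + (central n + central (1 + n)) ≡⟨ +-assoc (n C ⌊ m /2⌋) _ _ ⟨
    (n C ⌊ m /2⌋ + central n) + central (1 + n) ≡⟨ central-recurrence n ⌊ m /2⌋ refl ⟨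
    central (2 + n)                    ∎
    where open ≤-Reasoning

  central-≤-suc : ∀ n → central n ≤ central (suc n)
  central-≤-suc 0 = ≤-refl
  central-≤-suc 1 = s≤s z≤n
  central-≤-suc 2 = s≤s (s≤s z≤n)
  central-≤-suc (suc (suc (suc m))) =
    ≤-trans (m≤n+m _ (central (2 + m))) (≤-trans (m≤m+n _ 1) (central-grows (2 + m) (s≤s (s≤s z≤n))))

  central-mono : ∀ {m n} → m ≤ n → central m ≤ central n
  central-mono {m} m≤n with d , refl ← m≤n⇒∃[o]m+o≡n m≤n = up d
    where
    up : ∀ d → central m ≤ central (m + d)
    up zero = ≤-reflexive (cong central (sym (+-identityʳ m)))
    up (suc d) = ≤-trans (up d) (subst (λ k → central (m + d) ≤ central k) (sym (+-suc m d)) (central-≤-suc (m + d)))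

  central-split : ∀ n α β → 2 ≤ n → 2 ≤ α → 2 ≤ β → α + β ≡ 3 + n → central α + central β ≤ central n + central (1 + n)
  central-split n α β 2≤n 2≤α 2≤β α+β≡ with β ≤? 2
  ... | yes β≤2 with refl ← ≤-antisym β≤2 2≤β =
    subst (λ k → central k + central 2 ≤ central n + central (1 + n)) (sym α≡1+n)
      (subst (_≤ central n + central (1 + n)) (+-comm (central 2) _) (+-monoˡ-≤ _ (central-mono 2≤n)))
    where
    α≡1+n : α ≡ 1 + n
    α≡1+n = +-cancelʳ-≡ 2 α (1 + n) (trans α+β≡ (+-comm 2 (1 + n)))
  ... | no β≰2 = +-mono-≤ (central-mono α≤n) (central-mono β≤1+n)
    where
    α≤n : α ≤ n
    α≤n = +-cancelʳ-≤ 3 α n (subst (α + 3 ≤_) (trans α+β≡ (+-comm 3 n)) (+-monoʳ-≤ α (≰⇒> β≰2)))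
    β≤1+n : β ≤ 1 + n
    β≤1+n = +-cancelˡ-≤ 2 β (1 + n) (subst (2 + β ≤_) α+β≡ (+-monoˡ-≤ β 2≤α))

  central-room : ∀ α β → 2 ≤ α → 2 ≤ β → 5 ≤ α + β →
    central α + central β + 1 ≤ central (α + β) ×
    central α + central β + 1 + central (α + β) + 1 ≤ central (suc (α + β))
  central-room α β 2≤α 2≤β 5≤α+β with n , 3+n≡α+β ← m≤n⇒∃[o]m+o≡n (≤-trans (s≤s (s≤s (s≤s z≤n))) 5≤α+β) =
    subst (λ m → central α + central β + 1 ≤ central m) 3+n≡α+β
      (≤-trans lower (central-≤-suc (2 + n))) ,
    subst (λ m → central α + central β + 1 + central m + 1 ≤ central (suc m)) 3+n≡α+β
      (≤-trans (+-monoˡ-≤ 1 (+-monoˡ-≤ (central (3 + n)) lower)) (central-grows (2 + n) (s≤s (s≤s z≤n))))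
    where
    2≤n : 2 ≤ n
    2≤n = s≤s⁻¹ (s≤s⁻¹ (s≤s⁻¹ (subst (5 ≤_) (sym 3+n≡α+β) 5≤α+β)))
    lower : central α + central β + 1 ≤ central (2 + n)
    lower = ≤-trans (+-monoˡ-≤ 1 (central-split n α β 2≤n 2≤α 2≤β (sym 3+n≡α+β))) (central-grows n 2≤n)

  ⌊n/2⌋≡n/2 : ∀ n → ⌊ n /2⌋ ≡ n / 2
  ⌊n/2⌋≡n/2 0 = refl
  ⌊n/2⌋≡n/2 1 = refl
  ⌊n/2⌋≡n/2 (suc (suc n)) = trans (cong suc (⌊n/2⌋≡n/2 n)) (sym (m/n≡1+[m∸n]/n {suc (suc n)} {2} (s≤s (s≤s z≤n))))

module Sperner where
  open import Data.Bool using (Bool; true; false; not; _∧_)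
  open import Data.Empty using (⊥-elim)
  open import Data.Fin using (Fin; zero; suc; punchIn; punchOut)
  open import Data.Fin.Properties using (punchIn-punchOut; punchInᵢ≢i) renaming (_≟_ to _≟ᶠ_)
  open import Data.List using (List; []; _∷_; length)
  open import Data.Nat.ListAction using (sum)
  import Data.List as List
  open import Data.List.Relation.Unary.All using (All; []; _∷_)
  import Data.List.Relation.Unary.All as All
  open import Data.List.Relation.Unary.All.Properties using (¬Any⇒All¬; ¬All⇒Any¬)
  open import Data.List.Relation.Unary.Any using (Any; here; there)
  import Data.List.Relation.Unary.Any as Any
  open import Data.List.Relation.Unary.AllPairs using (AllPairs; []; _∷_)
  open import Data.Nat
  open Central using (central; binomial-identity; n∸⌊n/2⌋≡⌈n/2⌉)
  open import Data.Nat.Properties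
  open import Algebra.Properties.Semiring.Sum +-*-semiring
    using (sum-syntax; sum-remove; ∑-distrib-+; sum-cong-≗; *-distribʳ-sum)
  open import Data.Product using (_×_; _,_; proj₁; proj₂; ∃-syntax)
  open import Data.Sum using (_⊎_; inj₁; inj₂)
  open import Data.Vec.Functional using (Vector; removeAt)
  open import Function using (_∘_)
  open import Relation.Binary.PropositionalEquality
  open import Relation.Nullary using (¬_; yes; no; Dec; _⊎-dec_)

  private
    variable
      n : ℕ

  χ : Bool → ℕ
  χ false = 0
  χ true = 1

  ∣_∣ : Vector Bool n → ℕ
  ∣_∣ {n} E = ∑[ i < n ] χ (E i)

  _⊆_ : Vector Bool n → Vector Bool n → Set
  E ⊆ F = ∀ i → E i ≡ true → F i ≡ true

  Incomparable : Vector Bool n → Vector Bool n → Set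
  Incomparable E F = ¬ E ⊆ F × ¬ F ⊆ E

  Antichain : List (Vector Bool n) → Set
  Antichain = AllPairs Incomparable

  _∖_ : Vector Bool n → Vector Bool n → Vector Bool n
  (U ∖ E) i = not (E i) ∧ U i

  whole : Vector Bool n
  whole _ = true

  ∣∣-removeAt : (E : Vector Bool (suc n)) (i : Fin (suc n)) → ∣ E ∣ ≡ χ (E i) + ∣ removeAt E i ∣
  ∣∣-removeAt E i = sum-remove (χ ∘ E)

  ∣whole∣ : ∀ n → ∣ whole {n} ∣ ≡ n
  ∣whole∣ zero = refl
  ∣whole∣ (suc n) = cong suc (∣whole∣ n)

  ∣∣≡0⇒empty : (E : Vector Bool n) → ∣ E ∣ ≡ 0 → ∀ i → E i ≡ false
  ∣∣≡0⇒empty {suc n} E ∣E∣≡0 i with E i in Ei | m+n≡0⇒m≡0 (χ (E i)) (trans (sym (∣∣-removeAt E i)) ∣E∣≡0)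
  ... | false | _ = refl
  ... | true | ()

  ∈⇒∣∣≥1 : (E : Vector Bool n) → ∀ i → E i ≡ true → 1 ≤ ∣ E ∣
  ∈⇒∣∣≥1 {suc n} E i Ei rewrite ∣∣-removeAt E i | Ei = s≤s z≤n

  ∣∣-cong : {E F : Vector Bool n} → (∀ i → E i ≡ F i) → ∣ E ∣ ≡ ∣ F ∣
  ∣∣-cong E≗F = sum-cong-≗ (cong χ ∘ E≗F)

  ∣∣≥1⇒point : (E : Vector Bool n) → 1 ≤ ∣ E ∣ → ∃[ i ] E i ≡ true
  ∣∣≥1⇒point {suc n} E 1≤∣E∣ with E zero in E0
  ... | true  = zero , E0
  ... | false = let i , Ei = ∣∣≥1⇒point (E ∘ suc) 1≤∣E∣ in suc i , Ei

  ∣∣≥2⇒two-points : (E : Vector Bool n) → 2 ≤ ∣ E ∣ → ∃[ i ] ∃[ j ] (i ≢ j × E i ≡ true × E j ≡ true)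
  ∣∣≥2⇒two-points {suc n} E 2≤∣E∣ with ∣∣≥1⇒point E (≤-trans (s≤s z≤n) 2≤∣E∣)
  ... | i , Ei with ∣∣≥1⇒point (removeAt E i) (s≤s⁻¹ (subst (2 ≤_) (trans (∣∣-removeAt E i) (cong (λ b → χ b + ∣ removeAt E i ∣) Ei)) 2≤∣E∣))
  ...   | j , Ej = i , punchIn i j , (punchInᵢ≢i i j ∘ sym) , Ei , Ej

  two-points⇒∣∣≥2 : (E : Vector Bool n) {i j : Fin n} → i ≢ j → E i ≡ true → E j ≡ true → 2 ≤ ∣ E ∣
  two-points⇒∣∣≥2 {suc n} E {i} {j} i≢j Ei Ej rewrite ∣∣-removeAt E i | Ei =
    s≤s (∈⇒∣∣≥1 (removeAt E i) (punchOut i≢j) (trans (cong E (punchIn-punchOut i≢j)) Ej))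

  χ-mono : ∀ {a b} → (a ≡ true → b ≡ true) → χ a ≤ χ b
  χ-mono {false} _ = z≤n
  χ-mono {true} a⇒b rewrite a⇒b refl = ≤-refl

  ⊆⇒∣∣≤ : {E F : Vector Bool n} → E ⊆ F → ∣ E ∣ ≤ ∣ F ∣
  ⊆⇒∣∣≤ {zero} E⊆F = z≤n
  ⊆⇒∣∣≤ {suc n} E⊆F = +-mono-≤ (χ-mono (E⊆F zero)) (⊆⇒∣∣≤ (E⊆F ∘ suc))

  ∣∣-split : {E U : Vector Bool n} → E ⊆ U → ∣ E ∣ + ∣ U ∖ E ∣ ≡ ∣ U ∣
  ∣∣-split {n} {E} {U} E⊆U = trans (sym (∑-distrib-+ (χ ∘ E) (χ ∘ (U ∖ E)))) (sum-cong-≗ pointwise)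
    where
    pointwise : ∀ i → χ (E i) + χ ((U ∖ E) i) ≡ χ (U i)
    pointwise i with E i in Ei | U i in Ui
    ... | false | _ = refl
    ... | true | true = refl
    ... | true | false with () ← trans (sym (E⊆U i Ei)) Ui

  ∑-mono-≤ : {f g : Vector ℕ n} → (∀ i → f i ≤ g i) → ∑[ i < n ] f i ≤ ∑[ i < n ] g i
  ∑-mono-≤ {zero} f≤g = z≤n
  ∑-mono-≤ {suc n} f≤g = +-mono-≤ (f≤g zero) (∑-mono-≤ (f≤g ∘ suc))

  ∑-mono-< : {f g : Vector ℕ n} → (∀ i → f i ≤ g i) → ∀ j → f j < g j → ∑[ i < n ] f i < ∑[ i < n ] g i
  ∑-mono-< {suc n} f≤g zero fj<gj = +-mono-<-≤ fj<gj (∑-mono-≤ (f≤g ∘ suc))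
  ∑-mono-< {suc n} f≤g (suc j) fj<gj = +-mono-≤-< (f≤g zero) (∑-mono-< (f≤g ∘ suc) j fj<gj)

  ∑-const : ∀ n c → ∑[ i < n ] c ≡ n * c
  ∑-const zero c = refl
  ∑-const (suc n) c = cong (c +_) (∑-const n c)

  weight : Vector Bool n → Vector Bool n → ℕ
  weight U E = ∣ E ∣ ! * ∣ U ∖ E ∣ !

  totalWeight : Vector Bool n → List (Vector Bool n) → ℕ
  totalWeight U L = sum (List.map (weight U) L)

  -- Each maximal chain from U down to E starts by removing one of the points of U ∖ E.
  weight-decompose : (U E : Vector Bool (suc n)) → 1 ≤ ∣ U ∖ E ∣ →
    weight U E ≡ ∑[ x < suc n ] (χ ((U ∖ E) x) * weight (removeAt U x) (removeAt E x))
  weight-decompose {n} U E 1≤∣U∖E∣ with ∣ U ∖ E ∣ in ∣U∖E∣≡ | 1≤∣U∖E∣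
  ... | suc z | _ = sym (begin
    ∑[ x < suc n ] (χ (D x) * weight (removeAt U x) (removeAt E x)) ≡⟨ sum-cong-≗ pointwise ⟩
    ∑[ x < suc n ] (χ (D x) * (∣ E ∣ ! * z !))                        ≡⟨ *-distribʳ-sum (∣ E ∣ ! * z !) (χ ∘ D) ⟨
    ∣ D ∣ * (∣ E ∣ ! * z !)                                          ≡⟨ cong (_* (∣ E ∣ ! * z !)) ∣U∖E∣≡ ⟩
    suc z * (∣ E ∣ ! * z !)                                          ≡⟨ x*[y*z]≡y*[x*z] (suc z) (∣ E ∣ !) (z !) ⟩
    ∣ E ∣ ! * suc z !                                                ∎)
    where
    open ≡-Reasoning
    D = U ∖ E
    x*[y*z]≡y*[x*z] : ∀ a b c → a * (b * c) ≡ b * (a * c)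
    x*[y*z]≡y*[x*z] a b c = trans (sym (*-assoc a b c)) (trans (cong (_* c) (*-comm a b)) (*-assoc b a c))
    pointwise : ∀ x → χ (D x) * weight (removeAt U x) (removeAt E x) ≡ χ (D x) * (∣ E ∣ ! * z !)
    pointwise x with E x in Ex | U x in Ux
    ... | true | _ = refl
    ... | false | false = refl
    ... | false | true = cong (λ k → k + 0) (cong₂ (λ a b → a ! * b !) ∣E-x∣ ∣D-x∣)
      where
      ∣E-x∣ : ∣ removeAt E x ∣ ≡ ∣ E ∣
      ∣E-x∣ = sym (trans (∣∣-removeAt E x) (cong (λ b → χ b + ∣ removeAt E x ∣) Ex))
      ∣D-x∣ : ∣ removeAt D x ∣ ≡ z
      ∣D-x∣ = suc-injective (trans (cong (λ b → χ b + ∣ removeAt D x ∣) (sym (cong₂ (λ a b → not a ∧ b) Ex Ux)))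
                                (trans (sym (∣∣-removeAt D x)) ∣U∖E∣≡))

  restrict : Vector Bool (suc n) → Fin (suc n) → List (Vector Bool (suc n)) → List (Vector Bool n)
  restrict U x [] = []
  restrict U x (E ∷ L) with (U ∖ E) x
  ... | true = removeAt E x ∷ restrict U x L
  ... | false = restrict U x L

  totalWeight-decompose : (U : Vector Bool (suc n)) (L : List (Vector Bool (suc n))) →
    All (λ E → 1 ≤ ∣ U ∖ E ∣) L →
    totalWeight U L ≡ ∑[ x < suc n ] totalWeight (removeAt U x) (restrict U x L)
  totalWeight-decompose {n} U [] [] = sym (trans (∑-const (suc n) 0) (*-zeroʳ n))
  totalWeight-decompose {n} U (E ∷ L) (nonempty ∷ nonempties) = begin
    weight U E + totalWeight U L
      ≡⟨ cong₂ _+_ (weight-decompose U E nonempty) (totalWeight-decompose U L nonempties) ⟩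
    ∑[ x < suc n ] (χ ((U ∖ E) x) * weight (removeAt U x) (removeAt E x)) + ∑[ x < suc n ] totalWeight (removeAt U x) (restrict U x L)
      ≡⟨ ∑-distrib-+ (λ x → χ ((U ∖ E) x) * weight (removeAt U x) (removeAt E x)) (λ x → totalWeight (removeAt U x) (restrict U x L)) ⟨
    ∑[ x < suc n ] (χ ((U ∖ E) x) * weight (removeAt U x) (removeAt E x) + totalWeight (removeAt U x) (restrict U x L))
      ≡⟨ sum-cong-≗ pointwise ⟩
    ∑[ x < suc n ] totalWeight (removeAt U x) (restrict U x (E ∷ L)) ∎
    where
    open ≡-Reasoning
    pointwise : ∀ x → χ ((U ∖ E) x) * weight (removeAt U x) (removeAt E x) + totalWeight (removeAt U x) (restrict U x L)
                    ≡ totalWeight (removeAt U x) (restrict U x (E ∷ L))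
    pointwise x with (U ∖ E) x
    ... | true = cong (_+ totalWeight (removeAt U x) (restrict U x L)) (+-identityʳ _)
    ... | false = refl

  ∖⇒∉ : (U E : Vector Bool n) (x : Fin n) → (U ∖ E) x ≡ true → E x ≡ false
  ∖⇒∉ U E x Dx with E x
  ... | false = refl

  restrict-All : {P : Vector Bool (suc n) → Set} {Q : Vector Bool n → Set} (U : Vector Bool (suc n)) (x : Fin (suc n)) →
    (∀ E → E x ≡ false → P E → Q (removeAt E x)) → ∀ {L} → All P L → All Q (restrict U x L)
  restrict-All U x P⇒Q [] = []
  restrict-All U x P⇒Q {E ∷ L} (PE ∷ PL) with (U ∖ E) x in Dx
  ... | true = P⇒Q E (∖⇒∉ U E x Dx) PE ∷ restrict-All U x P⇒Q PL
  ... | false = restrict-All U x P⇒Q PL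

  restrict-empty : (U : Vector Bool (suc n)) (x : Fin (suc n)) → U x ≡ false → ∀ L → restrict U x L ≡ []
  restrict-empty U x Ux [] = refl
  restrict-empty U x Ux (E ∷ L) with E x
  ... | true = restrict-empty U x Ux L
  ... | false rewrite Ux = restrict-empty U x Ux L

  ⊆-removeAt⁻ : (E F : Vector Bool (suc n)) (x : Fin (suc n)) → E x ≡ false → removeAt E x ⊆ removeAt F x → E ⊆ F
  ⊆-removeAt⁻ E F x Ex sub i Ei with i ≟ᶠ x
  ... | yes refl with () ← trans (sym Ei) Ex
  ... | no i≢x = subst (λ k → F k ≡ true) (punchIn-punchOut x≢i)
                  (sub (punchOut x≢i) (subst (λ k → E k ≡ true) (sym (punchIn-punchOut x≢i)) Ei))
    where x≢i = i≢x ∘ sym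

  restrict-antichain : (U : Vector Bool (suc n)) (x : Fin (suc n)) → ∀ {L} → Antichain L → Antichain (restrict U x L)
  restrict-antichain U x [] = []
  restrict-antichain U x {E ∷ L} (incs ∷ anti) with (U ∖ E) x in Dx
  ... | true = restrict-All U x incomparable incs ∷ restrict-antichain U x anti
    where
    incomparable : ∀ E' → E' x ≡ false → Incomparable E E' → Incomparable (removeAt E x) (removeAt E' x)
    incomparable E' E'x (E⊈E' , E'⊈E) = E⊈E' ∘ ⊆-removeAt⁻ E E' x (∖⇒∉ U E x Dx) , E'⊈E ∘ ⊆-removeAt⁻ E' E x E'x
  ... | false = restrict-antichain U x anti

  ∣∣≡0⇒⊇ : (U E : Vector Bool n) → ∣ U ∖ E ∣ ≡ 0 → U ⊆ E
  ∣∣≡0⇒⊇ U E ∣U∖E∣≡0 i Ui with E i in Ei | ∣∣≡0⇒empty (U ∖ E) ∣U∖E∣≡0 i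
  ... | true | _ = refl
  ... | false | Ui≡false with () ← trans (sym Ui) Ui≡false

  ⊆-trans : {E F G : Vector Bool n} → E ⊆ F → F ⊆ G → E ⊆ G
  ⊆-trans E⊆F F⊆G i = F⊆G i ∘ E⊆F i

  -- If some member of an antichain of subsets of U contains U, it is the only member.
  totalWeight-cover : (U : Vector Bool n) (L : List (Vector Bool n)) → Antichain L → All (_⊆ U) L →
    Any (λ E → ∣ U ∖ E ∣ ≡ 0) L → totalWeight U L ≡ ∣ U ∣ !
  totalWeight-cover U (E ∷ []) _ (E⊆U ∷ []) (here ∣U∖E∣≡0) = begin
    ∣ E ∣ ! * ∣ U ∖ E ∣ ! + 0 ≡⟨ +-identityʳ _ ⟩
    ∣ E ∣ ! * ∣ U ∖ E ∣ !     ≡⟨ cong (λ k → ∣ E ∣ ! * k !) ∣U∖E∣≡0 ⟩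
    ∣ E ∣ ! * 1               ≡⟨ *-identityʳ _ ⟩
    ∣ E ∣ !                   ≡⟨ cong _! (≤-antisym (⊆⇒∣∣≤ E⊆U) (⊆⇒∣∣≤ (∣∣≡0⇒⊇ U E ∣U∖E∣≡0))) ⟩
    ∣ U ∣ !                   ∎
    where open ≡-Reasoning
  totalWeight-cover U (E ∷ E' ∷ L) (((_ , E'⊈E) ∷ _) ∷ _) (_ ∷ E'⊆U ∷ _) (here ∣U∖E∣≡0) =
    ⊥-elim (E'⊈E (⊆-trans E'⊆U (∣∣≡0⇒⊇ U E ∣U∖E∣≡0)))
  totalWeight-cover U (E ∷ L) (incs ∷ _) (E⊆U ∷ _) (there cover) with All.lookupAny incs cover
  ... | (E⊈E' , _) , ∣U∖E'∣≡0 = ⊥-elim (E⊈E' (⊆-trans E⊆U (∣∣≡0⇒⊇ U _ ∣U∖E'∣≡0)))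

  n*[n∸1]!≤n! : ∀ k → k * (k ∸ 1) ! ≤ k !
  n*[n∸1]!≤n! zero = z≤n
  n*[n∸1]!≤n! (suc k) = ≤-refl

  lym : (U : Vector Bool n) (L : List (Vector Bool n)) → Antichain L → All (_⊆ U) L → totalWeight U L ≤ ∣ U ∣ !
  lym U L anti sub with Any.any? (λ E → ∣ U ∖ E ∣ ≟ 0) L
  ... | yes cover = ≤-reflexive (totalWeight-cover U L anti sub cover)
  ... | no ¬cover = uncovered U L anti sub (All.map (λ ∣U∖E∣≢0 → n≢0⇒n>0 ∣U∖E∣≢0) (¬Any⇒All¬ L ¬cover))
    where
    uncovered : ∀ {n} (U : Vector Bool n) L → Antichain L → All (_⊆ U) L → All (λ E → 1 ≤ ∣ U ∖ E ∣) L →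
                totalWeight U L ≤ ∣ U ∣ !
    uncovered {zero} U [] _ _ _ = z≤n
    uncovered {zero} U (E ∷ L) _ _ (() ∷ _)
    uncovered {suc n} U L anti sub nonempty = begin
      totalWeight U L                                               ≡⟨ totalWeight-decompose U L nonempty ⟩
      ∑[ x < suc n ] totalWeight (removeAt U x) (restrict U x L) ≤⟨ ∑-mono-≤ restricted ⟩
      ∑[ x < suc n ] (χ (U x) * (∣ U ∣ ∸ 1) !)                   ≡⟨ *-distribʳ-sum ((∣ U ∣ ∸ 1) !) (χ ∘ U) ⟨
      ∣ U ∣ * (∣ U ∣ ∸ 1) !                                       ≤⟨ n*[n∸1]!≤n! ∣ U ∣ ⟩
      ∣ U ∣ !                                                     ∎
      where
      open ≤-Reasoning
      restricted : ∀ x → totalWeight (removeAt U x) (restrict U x L) ≤ χ (U x) * (∣ U ∣ ∸ 1) !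
      restricted x with U x in Ux
      ... | false = ≤-reflexive (cong (totalWeight (removeAt U x)) (restrict-empty U x Ux L))
      ... | true = begin
        totalWeight (removeAt U x) (restrict U x L) ≤⟨ lym (removeAt U x) (restrict U x L) (restrict-antichain U x anti)
                                                          (restrict-All U x (λ E _ E⊆U i → E⊆U (punchIn x i)) sub) ⟩
        ∣ removeAt U x ∣ !                           ≡⟨ cong _! (cong (_∸ 1) (trans (∣∣-removeAt U x) (cong (λ b → χ b + ∣ removeAt U x ∣) Ux))) ⟨
        (∣ U ∣ ∸ 1) !                                ≡⟨ +-identityʳ _ ⟨
        1 * (∣ U ∣ ∸ 1) !                            ∎

  Downset : (Fin n → ℕ) → Vector Bool n → Set
  Downset κ E = ∀ i j → κ i < κ j → E j ≡ true → E i ≡ true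

  argmax : (κ : Fin (suc n) → ℕ) → ∃[ y ] ∀ i → κ i ≤ κ y
  argmax {zero} κ = zero , λ { zero → ≤-refl }
  argmax {suc n} κ with argmax (κ ∘ suc)
  ... | y , κ≤κy with κ zero ≤? κ (suc y)
  ...   | yes κ0≤κy = suc y , λ { zero → κ0≤κy ; (suc i) → κ≤κy i }
  ...   | no κ0≰κy = zero , λ { zero → ≤-refl ; (suc i) → ≤-trans (κ≤κy i) (<⇒≤ (≰⇒> κ0≰κy)) }

  -- A point of maximal rank can be added last.
  downset-removeAt⁻ : (κ : Fin (suc n) → ℕ) (y : Fin (suc n)) → (∀ i → κ i ≤ κ y) → (E : Vector Bool (suc n)) →
    E y ≡ false → Downset (κ ∘ punchIn y) (removeAt E y) → Downset κ E
  downset-removeAt⁻ κ y κ≤κy E Ey down i j κi<κj Ej with j ≟ᶠ y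
  ... | yes refl with () ← trans (sym Ej) Ey
  ... | no j≢y with i ≟ᶠ y
  ...   | yes refl = ⊥-elim (<⇒≱ κi<κj (κ≤κy j))
  ...   | no i≢y = subst (λ k → E k ≡ true) (punchIn-punchOut y≢i)
                     (down (punchOut y≢i) (punchOut y≢j)
                       (subst₂ _<_ (cong κ (sym (punchIn-punchOut y≢i))) (cong κ (sym (punchIn-punchOut y≢j))) κi<κj)
                       (subst (λ k → E k ≡ true) (sym (punchIn-punchOut y≢j)) Ej))
    where
    y≢i = i≢y ∘ sym
    y≢j = j≢y ∘ sym

  -- The maximal chain that adds points in order of increasing rank meets no member of the antichain.
  lym-strict : (κ : Fin n → ℕ) (L : List (Vector Bool n)) → Antichain L → All (¬_ ∘ Downset κ) L →
    totalWeight whole L < n !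
  lym-strict κ L anti notDown with Any.any? (λ E → ∣ whole ∖ E ∣ ≟ 0) L
  ... | yes cover with All.lookupAny notDown cover
  ...   | notDownE , ∣whole∖E∣≡0 = ⊥-elim (notDownE (λ i _ _ _ → ∣∣≡0⇒⊇ whole _ ∣whole∖E∣≡0 i refl))
  lym-strict κ L anti notDown | no ¬cover =
    uncovered κ L anti notDown (All.map (λ ∣U∖E∣≢0 → n≢0⇒n>0 ∣U∖E∣≢0) (¬Any⇒All¬ L ¬cover))
    where
    uncovered : ∀ {n} (κ : Fin n → ℕ) L → Antichain L → All (¬_ ∘ Downset κ) L → All (λ E → 1 ≤ ∣ whole ∖ E ∣) L →
                totalWeight whole L < n !
    uncovered {zero} κ [] _ _ _ = s≤s z≤n
    uncovered {zero} κ (E ∷ L) _ _ (() ∷ _)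
    uncovered {suc n} κ L anti notDown nonempty with argmax κ
    ... | y , κ≤κy = begin-strict
      totalWeight whole L                                             ≡⟨ totalWeight-decompose whole L nonempty ⟩
      ∑[ x < suc n ] totalWeight (removeAt whole x) (restrict whole x L) <⟨ ∑-mono-< restricted y restricted-y ⟩
      ∑[ x < suc n ] (n !)                                            ≡⟨ ∑-const (suc n) (n !) ⟩
      suc n !                                                         ∎
      where
      open ≤-Reasoning
      restricted : ∀ x → totalWeight whole (restrict whole x L) ≤ n !
      restricted x = subst (λ k → totalWeight whole (restrict whole x L) ≤ k !) (∣whole∣ n)
        (lym whole (restrict whole x L) (restrict-antichain whole x anti) (restrict-All whole x (λ _ _ _ _ _ → refl) notDown))
      restricted-y : totalWeight whole (restrict whole y L) < n !
      restricted-y = lym-strict (κ ∘ punchIn y) (restrict whole y L) (restrict-antichain whole y anti)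
        (restrict-All whole y (λ E Ey notDownE → notDownE ∘ downset-removeAt⁻ κ y κ≤κy E Ey) notDown)

  Middle : ℕ → ℕ → Set
  Middle n k = k ≡ ⌊ n /2⌋ ⊎ k ≡ ⌈ n /2⌉

  middleWeight : ℕ → ℕ
  middleWeight n = ⌊ n /2⌋ ! * ⌈ n /2⌉ !

  ⌊a+[a+d]/2⌋ : ∀ a d → ⌊ a + (a + d) /2⌋ ≡ a + ⌊ d /2⌋
  ⌊a+[a+d]/2⌋ zero d = refl
  ⌊a+[a+d]/2⌋ (suc a) d = trans (cong (λ k → ⌊ suc k /2⌋) (+-suc a (a + d))) (cong suc (⌊a+[a+d]/2⌋ a d))

  ⌈a+[a+d]/2⌉ : ∀ a d → ⌈ a + (a + d) /2⌉ ≡ a + ⌈ d /2⌉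
  ⌈a+[a+d]/2⌉ a d = trans (cong ⌊_/2⌋ (sym (trans (cong (a +_) (+-suc a d)) (+-suc a (a + d))))) (⌊a+[a+d]/2⌋ a (suc d))

  factorial-shift : ∀ a d → suc a ! * (suc a + d) ! < a ! * suc (suc a + d) !
  factorial-shift a d = begin-strict
    (suc a * a !) * (suc a + d) !               ≡⟨ cong (_* (suc a + d) !) (*-comm (suc a) (a !)) ⟩
    (a ! * suc a) * (suc a + d) !               ≡⟨ *-assoc (a !) (suc a) _ ⟩
    a ! * (suc a * (suc a + d) !)               <⟨ *-monoʳ-< (a !) {{a !≢0}} (*-monoˡ-< ((suc a + d) !) {{(suc a + d) !≢0}}
                                                     (s≤s (s≤s (m≤m+n a d)))) ⟩
    a ! * (suc (suc a + d) * (suc a + d) !)     ∎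
    where open ≤-Reasoning

  balanced-≤ : ∀ a d → (a + ⌊ d /2⌋) ! * (a + ⌈ d /2⌉) ! ≤ a ! * (a + d) !
  balanced-< : ∀ a d → (a + ⌊ suc (suc d) /2⌋) ! * (a + ⌈ suc (suc d) /2⌉) ! < a ! * (a + suc (suc d)) !

  balanced-≤ a 0 = ≤-reflexive (cong (λ k → k ! * (a + 0) !) (+-identityʳ a))
  balanced-≤ a 1 = ≤-reflexive (cong (λ k → k ! * (a + 1) !) (+-identityʳ a))
  balanced-≤ a (suc (suc d)) = <⇒≤ (balanced-< a d)

  balanced-< a d = begin-strict
    (a + suc ⌊ d /2⌋) ! * (a + suc ⌈ d /2⌉) ! ≡⟨ cong₂ (λ x y → x ! * y !) (+-suc a _) (+-suc a _) ⟩
    (suc a + ⌊ d /2⌋) ! * (suc a + ⌈ d /2⌉) ! ≤⟨ balanced-≤ (suc a) d ⟩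
    suc a ! * (suc a + d) !                   <⟨ factorial-shift a d ⟩
    a ! * suc (suc a + d) !                   ≡⟨ cong (λ k → a ! * k !) (trans (+-suc a (suc d)) (cong suc (+-suc a d))) ⟨
    a ! * (a + suc (suc d)) !                 ∎
    where open ≤-Reasoning

  middleWeight-balanced : ∀ a d → middleWeight (a + (a + d)) ≡ (a + ⌊ d /2⌋) ! * (a + ⌈ d /2⌉) !
  middleWeight-balanced a d = cong₂ (λ x y → x ! * y !) (⌊a+[a+d]/2⌋ a d) (⌈a+[a+d]/2⌉ a d)

  middleWeight-≤ : ∀ a b → middleWeight (a + b) ≤ a ! * b !
  middleWeight-≤ a b with ≤-total a b
  ... | inj₁ a≤b with d , refl ← m≤n⇒∃[o]m+o≡n a≤b =
    subst (_≤ a ! * (a + d) !) (sym (middleWeight-balanced a d)) (balanced-≤ a d)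
  ... | inj₂ b≤a with d , refl ← m≤n⇒∃[o]m+o≡n b≤a = begin
    middleWeight ((b + d) + b)          ≡⟨ cong middleWeight (+-comm (b + d) b) ⟩
    middleWeight (b + (b + d))          ≡⟨ middleWeight-balanced b d ⟩
    (b + ⌊ d /2⌋) ! * (b + ⌈ d /2⌉) !  ≤⟨ balanced-≤ b d ⟩
    b ! * (b + d) !                     ≡⟨ *-comm (b !) _ ⟩
    (b + d) ! * b !                     ∎
    where open ≤-Reasoning

  middleWeight-balanced-< : ∀ a d → a ≢ ⌊ a + (a + d) /2⌋ → middleWeight (a + (a + d)) < a ! * (a + d) !
  middleWeight-balanced-< a 0 a≢ = ⊥-elim (a≢ (sym (trans (⌊a+[a+d]/2⌋ a 0) (+-identityʳ a))))
  middleWeight-balanced-< a 1 a≢ = ⊥-elim (a≢ (sym (trans (⌊a+[a+d]/2⌋ a 1) (+-identityʳ a))))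
  middleWeight-balanced-< a (suc (suc d)) _ =
    subst (_< a ! * (a + suc (suc d)) !) (sym (middleWeight-balanced a (suc (suc d)))) (balanced-< a d)

  lower-middle⇒upper-middle : ∀ a b → b ≡ ⌊ a + b /2⌋ → a ≡ ⌈ a + b /2⌉
  lower-middle⇒upper-middle a b b≡ = +-cancelʳ-≡ b a ⌈ a + b /2⌉
    (sym (trans (cong (⌈ a + b /2⌉ +_) b≡) (trans (+-comm ⌈ a + b /2⌉ _) (⌊n/2⌋+⌈n/2⌉≡n (a + b)))))

  middleWeight-< : ∀ a b → ¬ Middle (a + b) a → middleWeight (a + b) < a ! * b !
  middleWeight-< a b notMiddle with ≤-total a b
  ... | inj₁ a≤b with d , refl ← m≤n⇒∃[o]m+o≡n a≤b = middleWeight-balanced-< a d (notMiddle ∘ inj₁)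
  ... | inj₂ b≤a with d , refl ← m≤n⇒∃[o]m+o≡n b≤a = begin-strict
    middleWeight ((b + d) + b)   ≡⟨ cong middleWeight (+-comm (b + d) b) ⟩
    middleWeight (b + (b + d))   <⟨ middleWeight-balanced-< b d b≢ ⟩
    b ! * (b + d) !              ≡⟨ *-comm (b !) _ ⟩
    (b + d) ! * b !              ∎
    where
    open ≤-Reasoning
    b≢ : b ≢ ⌊ b + (b + d) /2⌋
    b≢ b≡ = notMiddle (inj₂ (lower-middle⇒upper-middle (b + d) b (trans b≡ (cong ⌊_/2⌋ (+-comm b (b + d))))))

  middle? : ∀ n k → Dec (Middle n k)
  middle? n k = (k ≟ ⌊ n /2⌋) ⊎-dec (k ≟ ⌈ n /2⌉)

  central-binomial : ∀ n → central n * middleWeight n ≡ n !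
  central-binomial n = subst (λ k → central n * (⌊ n /2⌋ ! * k !) ≡ n !) (n∸⌊n/2⌋≡⌈n/2⌉ n) (binomial-identity (⌊n/2⌋≤n n))

  middleWeight≢0 : ∀ n → NonZero (middleWeight n)
  middleWeight≢0 n = ⌊ n /2⌋ !* ⌈ n /2⌉ !≢0

  middleWeight-≤-weight : (U E : Vector Bool n) → E ⊆ U → middleWeight ∣ U ∣ ≤ weight U E
  middleWeight-≤-weight U E E⊆U = subst (λ k → middleWeight k ≤ weight U E) (∣∣-split E⊆U) (middleWeight-≤ ∣ E ∣ ∣ U ∖ E ∣)

  middleWeight-<-weight : (U E : Vector Bool n) → E ⊆ U → ¬ Middle ∣ U ∣ ∣ E ∣ → middleWeight ∣ U ∣ < weight U E
  middleWeight-<-weight U E E⊆U notMiddle = subst (λ k → middleWeight k < weight U E) (∣∣-split E⊆U)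
    (middleWeight-< ∣ E ∣ ∣ U ∖ E ∣ (notMiddle ∘ subst (λ k → Middle k ∣ E ∣) (∣∣-split E⊆U)))

  length*≤totalWeight : ∀ {c} (U : Vector Bool n) {L} → All (λ E → c ≤ weight U E) L → length L * c ≤ totalWeight U L
  length*≤totalWeight U [] = z≤n
  length*≤totalWeight U (c≤w ∷ c≤ws) = +-mono-≤ c≤w (length*≤totalWeight U c≤ws)

  length*<totalWeight : ∀ {c} (U : Vector Bool n) {L} → All (λ E → c ≤ weight U E) L → Any (λ E → c < weight U E) L →
    length L * c < totalWeight U L
  length*<totalWeight U (_ ∷ c≤ws) (here c<w) = +-mono-<-≤ c<w (length*≤totalWeight U c≤ws)
  length*<totalWeight U (c≤w ∷ c≤ws) (there c<ws) = +-mono-≤-< c≤w (length*<totalWeight U c≤ws c<ws)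

  sperner : (U : Vector Bool n) (L : List (Vector Bool n)) → Antichain L → All (_⊆ U) L → length L ≤ central ∣ U ∣
  sperner U L anti sub = *-cancelʳ-≤ (length L) _ (middleWeight ∣ U ∣) {{middleWeight≢0 ∣ U ∣}} (begin
    length L * middleWeight ∣ U ∣                ≤⟨ length*≤totalWeight U (All.map (middleWeight-≤-weight U _) sub) ⟩
    totalWeight U L                              ≤⟨ lym U L anti sub ⟩
    ∣ U ∣ !                                      ≡⟨ central-binomial ∣ U ∣ ⟨
    central ∣ U ∣ * middleWeight ∣ U ∣           ∎)
    where open ≤-Reasoning

  -- Equality in Sperner's theorem forces a whole middle layer, which contains a downset for every ranking.
  sperner-strict : (κ : Fin n → ℕ) (L : List (Vector Bool n)) → Antichain L →
    All (λ E → Downset κ E → ¬ Middle n ∣ E ∣) L → length L < central n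
  sperner-strict {n} κ L anti notMiddleDown = *-cancelʳ-< (middleWeight n) (length L) (central n) (begin-strict
    length L * middleWeight n     <⟨ length*weight<n! ⟩
    n !                           ≡⟨ central-binomial n ⟨
    central n * middleWeight n    ∎)
    where
    open ≤-Reasoning
    U : Vector Bool n
    U = whole
    sub : All (_⊆ U) L
    sub = All.tabulate (λ _ _ _ → refl)
    atLeastMiddle : All (λ E → middleWeight n ≤ weight U E) L
    atLeastMiddle = All.map (λ {E} E⊆U → subst (λ k → middleWeight k ≤ weight U E) (∣whole∣ n) (middleWeight-≤-weight U E E⊆U)) sub
    length*weight<n! : length L * middleWeight n < n !
    length*weight<n! with All.all? (λ E → middle? n ∣ E ∣) L
    ... | yes allMiddle = begin-strict
      length L * middleWeight n    ≤⟨ length*≤totalWeight U atLeastMiddle ⟩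
      totalWeight U L           <⟨ lym-strict κ L anti (All.zipWith (λ (notMid , mid) down → notMid down mid) (notMiddleDown , allMiddle)) ⟩
      n !                          ∎
    ... | no notAllMiddle = begin-strict
      length L * middleWeight n    <⟨ length*<totalWeight U atLeastMiddle (Any.map notMiddle⇒heavier (¬All⇒Any¬ (λ E → middle? n ∣ E ∣) L notAllMiddle)) ⟩
      totalWeight U L           ≤⟨ lym U L anti sub ⟩
      ∣ U ∣ !                   ≡⟨ cong _! (∣whole∣ n) ⟩
      n !                          ∎
      where
      notMiddle⇒heavier : ∀ {E} → ¬ Middle n ∣ E ∣ → middleWeight n < weight U E
      notMiddle⇒heavier {E} notMid = subst (λ k → middleWeight k < weight U E) (∣whole∣ n)
        (middleWeight-<-weight U E (λ _ _ → refl) (notMid ∘ subst (λ k → Middle k ∣ E ∣) (∣whole∣ n)))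

  middle-bounds : ∀ n k → 5 ≤ n → Middle (suc n) k → 3 ≤ k × k + 2 ≤ n
  middle-bounds (suc (suc (suc (suc (suc m))))) k (s≤s (s≤s (s≤s (s≤s (s≤s _))))) (inj₁ refl) =
    s≤s (s≤s (s≤s z≤n)) , ≤-trans (+-monoˡ-≤ 2 (s≤s (s≤s (s≤s (⌊n/2⌋≤n m))))) (≤-reflexive (+-comm (3 + m) 2))
  middle-bounds (suc (suc (suc (suc (suc m))))) k (s≤s (s≤s (s≤s (s≤s (s≤s _))))) (inj₂ refl) =
    s≤s (s≤s (s≤s z≤n)) , ≤-trans (+-monoˡ-≤ 2 (s≤s (s≤s (s≤s (⌈n/2⌉≤n m))))) (≤-reflexive (+-comm (3 + m) 2))

module Certificate where
  open import Data.Bool using (Bool; true; false; T; not; _∧_; _∨_)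
  import Data.Bool as Bool
  open import Data.Bool.ListAction using (all)
  open import Data.Bool.Properties using (T-∧; T-∨)
  open import Data.Empty using (⊥)
  open import Data.Fin using (Fin; zero; suc)
  open import Data.Fin.Properties using (all?; any?)
  open import Data.Fin.Subset using (Subset; _∈_; _∉_; _⊆_; inside; outside)
  open import Data.Fin.Subset.Properties using (_∈?_; _⊆?_)
  open import Data.List using (List; []; _∷_; map; foldr; _++_; filter; cartesianProduct; cartesianProductWith)
  open import Data.List.Membership.Propositional using () renaming (_∈_ to _∈ˡ_)
  open import Data.List.Membership.Propositional.Properties using (∈-map⁺; ∈-++⁺ˡ; ∈-++⁺ʳ; ∈-filter⁺; ∈-cartesianProductWith⁺; ∈-cartesianProduct⁺)
  open import Data.List.Relation.Unary.Any using (here; there)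
  open import Data.Nat using (ℕ; zero; suc; _+_; _*_; _≤_; _≤?_; _<_; _<?_)
  open import Data.Nat.Properties using (+-mono-≤; *-monoˡ-≤)
  open import Data.Nat.Solver using (module +-*-Solver)
  open import Data.Product using (_×_; _,_; ∃-syntax; proj₁; proj₂)
  open import Data.Sum using (_⊎_; inj₁; inj₂)
  open import Data.Unit using (⊤; tt)
  open import Data.Vec using ([]; _∷_)
  open import Data.Vec.Properties using (≡-dec)
  open import Function using (_∘_)
  open import Function.Bundles using (Equivalence)
  open import Relation.Binary.PropositionalEquality using (_≡_; _≢_; refl; subst; sym; trans; cong)
  open import Data.Nat.ListAction using (sum)
  open import Relation.Nullary using (Dec; yes; no; does; ¬_; ¬?; _×-dec_; _⊎-dec_; _→-dec_)
  open import Relation.Nullary.Decidable using (map′)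

  data Side : Set where
    A B : Side

  data Status : Set where
    empty proper full : Status

  data Regime : Set where
    singletonA singletonB bothLarge : Regime

  record Profile : Set where
    constructor profile
    field
      out             : Subset 3
      statusA statusB : Status

  open Profile public

  status : Profile → Side → Status
  status t A = statusA t
  status t B = statusB t

  Single : Regime → Side → Set
  Single singletonA A = ⊤
  Single singletonB B = ⊤
  Single _          _ = ⊥

  Types : Set
  Types = Side → Subset 3

  record Feasible (type : Types) (r : Regime) (t : Profile) : Set where
    field
      from-x    : ∀ i → i ∈ out t → ∃[ σ ] (i ∈ type σ × status t σ ≢ full)
      to-x      : ∀ i → i ∉ out t → ∃[ σ ] (i ∉ type σ × status t σ ≢ empty)
      back-from : ∀ σ → status t σ ≢ empty → ∃[ i ] (i ∉ type σ × i ∉ out t)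
      back-to   : ∀ σ → status t σ ≢ full → ∃[ i ] (i ∈ type σ × i ∈ out t)
      sharp     : ∀ σ → Single r σ → status t σ ≢ proper

  data Mode : Set where
    keep fill clear : Mode

  record Code : Set where
    constructor code
    field
      tag         : Bool
      modeA modeB : Mode

  open Code public

  mode : Code → Side → Mode
  mode c A = modeA c
  mode c B = modeB c

  apply : Mode → Bool → Bool
  apply keep  b = b
  apply fill  _ = true
  apply clear _ = false

  plain : Code
  plain = code false keep keep

  Inclusion : Bool → Status → Status → Set
  Inclusion true  s s' = (s ≢ empty → s' ≢ empty) × (s' ≢ full → s ≢ full)
  Inclusion false s s' = s ≢ empty × s' ≢ full

  Compatible : Mode → Mode → Bool → Status → Status → Set
  Compatible clear _     _ _ _  = ⊤
  Compatible keep  keep  b _ _  = T b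
  Compatible keep  fill  _ _ _  = ⊤
  Compatible keep  clear _ s _  = s ≡ empty
  Compatible fill  keep  _ _ s' = s' ≡ full
  Compatible fill  fill  _ _ _  = ⊤
  Compatible fill  clear _ _ _  = ⊥

  choose : Bool → Bool → Side → Bool
  choose a b A = a
  choose a b B = b

  Faithful : Code → Profile → Code → Profile → Set
  Faithful c t c' t' = ∀ a b →
    (∀ σ → Inclusion (choose a b σ) (status t σ) (status t' σ)) →
    (T (tag c) → T (tag c')) →
    (∀ σ → Compatible (mode c σ) (mode c' σ) (choose a b σ) (status t σ) (status t' σ)) →
    out t ⊆ out t' × T a × T b

  data Block : Set where
    tagBit : Block
    block  : Side → Block

  Meets : Code → Profile → Block → Set
  Meets c t tagBit = T (tag c)
  Meets c t (block σ) with mode c σ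
  ... | keep  = status t σ ≢ empty
  ... | fill  = ⊤
  ... | clear = ⊥

  Misses : Code → Profile → Block → Set
  Misses c t tagBit = T (not (tag c))
  Misses c t (block σ) with mode c σ
  ... | keep  = status t σ ≢ full
  ... | fill  = ⊥
  ... | clear = ⊤

  infix 4 _≺_≺_
  record Order : Set where
    constructor _≺_≺_
    field
      first second third : Block

  _≟ᵇ_ : (β β' : Block) → Dec (β ≡ β')
  tagBit  ≟ᵇ tagBit  = yes refl
  tagBit  ≟ᵇ block _ = no λ ()
  block _ ≟ᵇ tagBit  = no λ ()
  block A ≟ᵇ block A = yes refl
  block A ≟ᵇ block B = no λ ()
  block B ≟ᵇ block A = no λ ()
  block B ≟ᵇ block B = yes refl

  position : Order → Block → ℕ
  position o β with β ≟ᵇ Order.first o | β ≟ᵇ Order.second o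
  ... | yes _ | _     = 0
  ... | no _  | yes _ = 1
  ... | no _  | no _  = 2

  NotInitial : Order → Code → Profile → Set
  NotInitial o c t = ∃[ β ] ∃[ β' ] (position o β < position o β' × Misses c t β × Meets c t β')

  other : Side → Side
  other A = B
  other B = A

  Lopsided : Regime → Code → Profile → Set
  Lopsided r c t = ∃[ σ ] (Single r σ × (¬ Meets c t (block (other σ)) ⊎ ¬ Misses c t (block (other σ))))

  record CodingValid (type : Types) (r : Regime) (o : Order) (κ : Subset 3 → Code) : Set where
    field
      faithful  : ∀ t → Feasible type r t → ∀ t' → Feasible type r t' → Faithful (κ (out t)) t (κ (out t')) t'
      nonMiddle : ∀ t → Feasible type r t → NotInitial o (κ (out t)) t ⊎ Lopsided r (κ (out t)) t

  Impossible : Types → Regime → Set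
  Impossible type r = (∀ t → ¬ Feasible type r t) ⊎ ∃[ σ ] (¬ Single r σ × (∀ t → Feasible type r t → status t σ ≢ proper))

  Fixed : Types → Regime → Subset 3 → Side → Set
  Fixed type r X σ = (∀ t → Feasible type r t → out t ≡ X → status t σ ≡ empty) ⊎
                     (∀ t → Feasible type r t → out t ≡ X → status t σ ≡ full)

  record Tally : Set where
    constructor tally
    field
      trivial onlyA onlyB both : ℕ

  _⊕_ : Tally → Tally → Tally
  tally a b c d ⊕ tally a' b' c' d' = tally (a + a') (b + b') (c + c') (d + d')

  infix 4 _≤ᵗ_
  _≤ᵗ_ : Tally → Tally → Set
  tally a b c d ≤ᵗ tally a' b' c' d' = a ≤ a' × b ≤ b' × c ≤ c' × d ≤ d'

  groupTally : (absent fixedA fixedB : Bool) → Tally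
  groupTally true  _     _     = tally 0 0 0 0
  groupTally false true  true  = tally 1 0 0 0
  groupTally false false true  = tally 0 1 0 0
  groupTally false true  false = tally 0 0 1 0
  groupTally false false false = tally 0 0 0 1

  _≟ˢ_ : (s s' : Status) → Dec (s ≡ s')
  empty  ≟ˢ empty  = yes refl
  empty  ≟ˢ proper = no λ ()
  empty  ≟ˢ full   = no λ ()
  proper ≟ˢ empty  = no λ ()
  proper ≟ˢ proper = yes refl
  proper ≟ˢ full   = no λ ()
  full   ≟ˢ empty  = no λ ()
  full   ≟ˢ proper = no λ ()
  full   ≟ˢ full   = yes refl

  _≢?_ : (s s' : Status) → Dec (s ≢ s')
  s ≢? s' = ¬? (s ≟ˢ s')

  _≟ˣ_ : (X Y : Subset 3) → Dec (X ≡ Y)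
  _≟ˣ_ = ≡-dec Bool._≟_

  T? : ∀ b → Dec (T b)
  T? true = yes tt
  T? false = no λ ()

  ∀-side? : {P : Side → Set} → (∀ σ → Dec (P σ)) → Dec (∀ σ → P σ)
  ∀-side? P? = map′ (λ { (a , b) A → a ; (a , b) B → b }) (λ h → h A , h B) (P? A ×-dec P? B)

  ∃-side? : {P : Side → Set} → (∀ σ → Dec (P σ)) → Dec (∃[ σ ] P σ)
  ∃-side? P? = map′ (λ { (inj₁ a) → A , a ; (inj₂ b) → B , b }) (λ { (A , a) → inj₁ a ; (B , b) → inj₂ b }) (P? A ⊎-dec P? B)

  ∀-bool? : {P : Bool → Set} → (∀ b → Dec (P b)) → Dec (∀ b → P b)
  ∀-bool? P? = map′ (λ { (f , t) false → f ; (f , t) true → t }) (λ h → h false , h true) (P? false ×-dec P? true)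

  single? : ∀ r σ → Dec (Single r σ)
  single? singletonA A = yes tt
  single? singletonA B = no λ ()
  single? singletonB A = no λ ()
  single? singletonB B = yes tt
  single? bothLarge  _ = no λ ()

  feasible? : ∀ type r t → Dec (Feasible type r t)
  feasible? type r t = map′
    (λ (f , g , h , k , l) → record { from-x = f ; to-x = g ; back-from = h ; back-to = k ; sharp = l })
    (λ feasible → let open Feasible feasible in from-x , to-x , back-from , back-to , sharp)
    ( all? (λ i → i ∈? out t →-dec ∃-side? λ σ → i ∈? type σ ×-dec status t σ ≢? full)
    ×-dec all? (λ i → ¬? (i ∈? out t) →-dec ∃-side? λ σ → ¬? (i ∈? type σ) ×-dec status t σ ≢? empty)
    ×-dec ∀-side? (λ σ → status t σ ≢? empty →-dec any? λ i → ¬? (i ∈? type σ) ×-dec ¬? (i ∈? out t))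
    ×-dec ∀-side? (λ σ → status t σ ≢? full →-dec any? λ i → i ∈? type σ ×-dec i ∈? out t)
    ×-dec ∀-side? (λ σ → single? r σ →-dec status t σ ≢? proper))

  inclusion? : ∀ b s s' → Dec (Inclusion b s s')
  inclusion? true  s s' = (s ≢? empty →-dec s' ≢? empty) ×-dec (s' ≢? full →-dec s ≢? full)
  inclusion? false s s' = s ≢? empty ×-dec s' ≢? full

  compatible? : ∀ m m' b s s' → Dec (Compatible m m' b s s')
  compatible? clear _     _ _ _  = yes tt
  compatible? keep  keep  b _ _  = T? b
  compatible? keep  fill  _ _ _  = yes tt
  compatible? keep  clear _ s _  = s ≟ˢ empty
  compatible? fill  keep  _ _ s' = s' ≟ˢ full
  compatible? fill  fill  _ _ _  = yes tt
  compatible? fill  clear _ _ _  = no λ ()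

  faithful? : ∀ c t c' t' → Dec (Faithful c t c' t')
  faithful? c t c' t' = ∀-bool? λ a → ∀-bool? λ b →
    ∀-side? (λ σ → inclusion? (choose a b σ) (status t σ) (status t' σ)) →-dec
    ((T? (tag c) →-dec T? (tag c')) →-dec
    (∀-side? (λ σ → compatible? (mode c σ) (mode c' σ) (choose a b σ) (status t σ) (status t' σ)) →-dec
    (out t ⊆? out t' ×-dec T? a ×-dec T? b)))

  meets? : ∀ c t β → Dec (Meets c t β)
  meets? c t tagBit = T? (tag c)
  meets? c t (block σ) with mode c σ
  ... | keep  = status t σ ≢? empty
  ... | fill  = yes tt
  ... | clear = no λ ()

  misses? : ∀ c t β → Dec (Misses c t β)
  misses? c t tagBit = T? (not (tag c))
  misses? c t (block σ) with mode c σ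
  ... | keep  = status t σ ≢? full
  ... | fill  = no λ ()
  ... | clear = yes tt

  ∃-block? : {P : Block → Set} → (∀ β → Dec (P β)) → Dec (∃[ β ] P β)
  ∃-block? P? = map′ (λ { (inj₁ p) → tagBit , p ; (inj₂ (σ , p)) → block σ , p })
                     (λ { (tagBit , p) → inj₁ p ; (block σ , p) → inj₂ (σ , p) }) (P? tagBit ⊎-dec ∃-side? (P? ∘ block))

  notInitial? : ∀ o c t → Dec (NotInitial o c t)
  notInitial? o c t = ∃-block? λ β → ∃-block? λ β' → position o β <? position o β' ×-dec misses? c t β ×-dec meets? c t β'

  lopsided? : ∀ r c t → Dec (Lopsided r c t)
  lopsided? r c t = ∃-side? λ σ → single? r σ ×-dec (¬? (meets? c t (block (other σ))) ⊎-dec ¬? (misses? c t (block (other σ))))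

  infixr 5 _⇒_
  _⇒_ : Bool → Bool → Bool
  a ⇒ b = not a ∨ b

  ⇒-sound : ∀ {a b} → T (a ⇒ b) → T a → T b
  ⇒-sound {true} b _ = b

  ∧-sound : ∀ {a b} → T (a ∧ b) → T a × T b
  ∧-sound = Equivalence.to T-∧

  ∨-sound : ∀ {a b} → T (a ∨ b) → T a ⊎ T b
  ∨-sound = Equivalence.to T-∨

  ⌊_⌋ : ∀ {P : Set} → Dec P → Bool
  ⌊ P? ⌋ = does P?

  toWitness : ∀ {P : Set} (P? : Dec P) → T ⌊ P? ⌋ → P
  toWitness (yes p) _ = p

  fromWitness : ∀ {P : Set} (P? : Dec P) → P → T ⌊ P? ⌋
  fromWitness (yes _) _ = tt
  fromWitness (no ¬p) p = ¬p p

  all-sound : ∀ {A : Set} (p : A → Bool) {xs} → T (all p xs) → ∀ {x} → x ∈ˡ xs → T (p x)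
  all-sound p {x ∷ xs} holds (here refl) = proj₁ (∧-sound {p x} holds)
  all-sound p {x ∷ xs} holds (there x∈xs) = all-sound p (proj₂ (∧-sound {p x} holds)) x∈xs

  subsets : ∀ n → List (Subset n)
  subsets zero    = [] ∷ []
  subsets (suc n) = map (outside ∷_) (subsets n) ++ map (inside ∷_) (subsets n)

  ∈-subsets : ∀ {n} (X : Subset n) → X ∈ˡ subsets n
  ∈-subsets []            = here refl
  ∈-subsets (outside ∷ X) = ∈-++⁺ˡ (∈-map⁺ (outside ∷_) (∈-subsets X))
  ∈-subsets (inside ∷ X)  = ∈-++⁺ʳ _ (∈-map⁺ (inside ∷_) (∈-subsets X))

  statuses : List Status
  statuses = empty ∷ proper ∷ full ∷ []

  ∈-statuses : ∀ s → s ∈ˡ statuses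
  ∈-statuses empty  = here refl
  ∈-statuses proper = there (here refl)
  ∈-statuses full   = there (there (here refl))

  regimes : List Regime
  regimes = singletonA ∷ singletonB ∷ bothLarge ∷ []

  ∈-regimes : ∀ r → r ∈ˡ regimes
  ∈-regimes singletonA = here refl
  ∈-regimes singletonB = there (here refl)
  ∈-regimes bothLarge  = there (there (here refl))

  profiles : List Profile
  profiles = cartesianProductWith (λ X (a , b) → profile X a b) (subsets 3) (cartesianProduct statuses statuses)

  ∈-profiles : ∀ t → t ∈ˡ profiles
  ∈-profiles (profile X a b) = ∈-cartesianProductWith⁺ (λ X (a , b) → profile X a b) (∈-subsets X)
    (∈-cartesianProduct⁺ (∈-statuses a) (∈-statuses b))

  opaque
    feasibles : Types → Regime → List Profile
    feasibles type r = filter (feasible? type r) profiles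

    ∈-feasibles : ∀ {type r t} → Feasible type r t → t ∈ˡ feasibles type r
    ∈-feasibles {type} {r} {t} feasible = ∈-filter⁺ (feasible? type r) (∈-profiles t) feasible

  codingCheck : Regime → Order → (Subset 3 → Code) → List Profile → Bool
  codingCheck r o κ fs = all (λ t → nonMiddleᵇ t ∧ all (faithfulᵇ t) fs) fs
    module CodingCheck where
    nonMiddleᵇ : Profile → Bool
    nonMiddleᵇ t = ⌊ notInitial? o (κ (out t)) t ⊎-dec lopsided? r (κ (out t)) t ⌋
    faithfulᵇ : Profile → Profile → Bool
    faithfulᵇ t t' = ⌊ faithful? (κ (out t)) t (κ (out t')) t' ⌋

  codingValid-sound : ∀ {type r o κ} → T (codingCheck r o κ (feasibles type r)) → CodingValid type r o κ
  codingValid-sound {type} {r} {o} {κ} holds = record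
    { faithful  = λ t ft t' ft' → toWitness (faithful? _ t _ t') (all-sound (faithfulᵇ t) (proj₂ (atFeasible ft)) (∈-feasibles ft'))
    ; nonMiddle = λ t ft → toWitness (notInitial? o _ t ⊎-dec lopsided? r _ t) (proj₁ (atFeasible ft)) }
    where
    open CodingCheck r o κ (feasibles type r)
    atFeasible : ∀ {t} → Feasible type r t → T (nonMiddleᵇ t) × T (all (faithfulᵇ t) (feasibles type r))
    atFeasible {t} ft = ∧-sound {nonMiddleᵇ t} (all-sound (λ t → nonMiddleᵇ t ∧ all (faithfulᵇ t) (feasibles type r)) holds (∈-feasibles ft))

  neverProperCheck : Regime → List Profile → Side → Bool
  neverProperCheck r fs σ = ⌊ ¬? (single? r σ) ⌋ ∧ all (λ t → ⌊ status t σ ≢? proper ⌋) fs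

  neverProper-sound : ∀ {type r} σ → T (neverProperCheck r (feasibles type r) σ) →
    ¬ Single r σ × (∀ t → Feasible type r t → status t σ ≢ proper)
  neverProper-sound {type} {r} σ holds with ∧-sound {⌊ ¬? (single? r σ) ⌋} holds
  ... | notSingle , notProper = toWitness (¬? (single? r σ)) notSingle
    , λ t ft → toWitness (status t σ ≢? proper) (all-sound (λ t → ⌊ status t σ ≢? proper ⌋) notProper (∈-feasibles ft))

  impossibleCheck : Regime → List Profile → Bool
  impossibleCheck r fs = all (λ _ → false) fs ∨ neverProperCheck r fs A ∨ neverProperCheck r fs B

  impossible-sound : ∀ {type r} → T (impossibleCheck r (feasibles type r)) → Impossible type r
  impossible-sound {type} {r} holds with ∨-sound {all (λ _ → false) (feasibles type r)} holds
  ... | inj₁ noneFeasible = inj₁ (λ t ft → all-sound (λ _ → false) noneFeasible (∈-feasibles ft))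
  ... | inj₂ never with ∨-sound {neverProperCheck r (feasibles type r) A} never
  ...   | inj₁ neverA = inj₂ (A , neverProper-sound A neverA)
  ...   | inj₂ neverB = inj₂ (B , neverProper-sound B neverB)

  groupsTally : List Profile → Tally
  groupsTally fs = foldr (λ X → groupTally (absent X) (fixed X A) (fixed X B) ⊕_) (tally 0 0 0 0) (subsets 3)
    module Groups where
    absent : Subset 3 → Bool
    absent X = all (λ t → not ⌊ out t ≟ˣ X ⌋) fs
    constantly : Subset 3 → Side → Status → Bool
    constantly X σ s = all (λ t → ⌊ out t ≟ˣ X ⌋ ⇒ ⌊ status t σ ≟ˢ s ⌋) fs
    fixed : Subset 3 → Side → Bool
    fixed X σ = constantly X σ empty ∨ constantly X σ full

  module _ {type : Types} {r : Regime} where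
    open Groups (feasibles type r)

    absent-sound : ∀ {X} → T (absent X) → ∀ t → Feasible type r t → out t ≢ X
    absent-sound {X} holds t ft out≡X =
      T-not (all-sound (λ t → not ⌊ out t ≟ˣ X ⌋) holds (∈-feasibles ft)) (fromWitness (out t ≟ˣ X) out≡X)
      where
      T-not : ∀ {b} → T (not b) → T b → ⊥
      T-not {false} _ ()

    constantly-sound : ∀ {X σ} s → T (constantly X σ s) → ∀ t → Feasible type r t → out t ≡ X → status t σ ≡ s
    constantly-sound {X} {σ} s holds t ft out≡X = toWitness (status t σ ≟ˢ s)
      (⇒-sound {⌊ out t ≟ˣ X ⌋} (all-sound (λ t → ⌊ out t ≟ˣ X ⌋ ⇒ ⌊ status t σ ≟ˢ s ⌋) holds (∈-feasibles ft))
        (fromWitness (out t ≟ˣ X) out≡X))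

    fixed-sound : ∀ {X} σ → T (fixed X σ) → Fixed type r X σ
    fixed-sound {X} σ holds with ∨-sound {constantly X σ empty} holds
    ... | inj₁ allEmpty = inj₁ (constantly-sound {σ = σ} empty allEmpty)
    ... | inj₂ allFull  = inj₂ (constantly-sound {σ = σ} full allFull)

  Affordable : Tally → Set
  Affordable t = t ≤ᵗ tally 1 1 1 1 ⊎ t ≤ᵗ tally 2 2 2 0

  affordable? : ∀ t → Dec (Affordable t)
  affordable? (tally a b c d) =
    (a ≤? 1 ×-dec b ≤? 1 ×-dec c ≤? 1 ×-dec d ≤? 1) ⊎-dec (a ≤? 2 ×-dec b ≤? 2 ×-dec c ≤? 2 ×-dec d ≤? 0)

  record GroupingValid (type : Types) (r : Regime) : Set where
    field
      large      : r ≡ bothLarge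
      affordable : Affordable (groupsTally (feasibles type r))

  _≟ʳ_ : (r r' : Regime) → Dec (r ≡ r')
  singletonA ≟ʳ singletonA = yes refl
  singletonB ≟ʳ singletonB = yes refl
  bothLarge  ≟ʳ bothLarge  = yes refl
  singletonA ≟ʳ singletonB = no λ ()
  singletonA ≟ʳ bothLarge  = no λ ()
  singletonB ≟ʳ singletonA = no λ ()
  singletonB ≟ʳ bothLarge  = no λ ()
  bothLarge  ≟ʳ singletonA = no λ ()
  bothLarge  ≟ʳ singletonB = no λ ()

  groupingCheck : Regime → List Profile → Bool
  groupingCheck r fs = ⌊ r ≟ʳ bothLarge ⌋ ∧ ⌊ affordable? (groupsTally fs) ⌋

  groupingValid-sound : ∀ {type r} → T (groupingCheck r (feasibles type r)) → GroupingValid type r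
  groupingValid-sound {type} {r} holds with ∧-sound {⌊ r ≟ʳ bothLarge ⌋} holds
  ... | large , affordable = record
    { large = toWitness (r ≟ʳ bothLarge) large ; affordable = toWitness (affordable? _) affordable }

  data Strategy : Set where
    impossible : Strategy
    coded      : Order → (Subset 3 → Code) → Strategy
    grouped    : Strategy

  Valid : Types → Regime → Strategy → Set
  Valid type r impossible  = Impossible type r
  Valid type r (coded o κ) = CodingValid type r o κ
  Valid type r grouped     = GroupingValid type r

  validCheck : Regime → Strategy → List Profile → Bool
  validCheck r impossible  = impossibleCheck r
  validCheck r (coded o κ) = codingCheck r o κ
  validCheck r grouped     = groupingCheck r

  valid-sound : ∀ {type r} s → T (validCheck r s (feasibles type r)) → Valid type r s
  valid-sound impossible  = impossible-sound
  valid-sound (coded o κ) = codingValid-sound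
  valid-sound grouped     = groupingValid-sound

  pattern ● = inside
  pattern ○ = outside
  pattern ⟨_,_,_⟩ a b c = a ∷ b ∷ c ∷ []

  types : Subset 3 → Subset 3 → Types
  types X Y A = X
  types X Y B = Y

  opaque
    strategy : Subset 3 → Subset 3 → Regime → Strategy
    strategy ⟨ ○ , ○ , ○ ⟩ ⟨ ○ , ○ , ● ⟩ singletonA = coded (tagBit ≺ block B ≺ block A)
      λ { ⟨ ○ , ○ , ● ⟩ → code true keep keep ; _ → plain }
    strategy ⟨ ○ , ○ , ○ ⟩ ⟨ ○ , ● , ○ ⟩ singletonA = coded (tagBit ≺ block B ≺ block A)
      λ { ⟨ ○ , ● , ○ ⟩ → code true keep keep ; _ → plain }
    strategy ⟨ ○ , ○ , ○ ⟩ ⟨ ○ , ● , ● ⟩ singletonA = coded (block B ≺ tagBit ≺ block A)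
      λ { ⟨ ○ , ○ , ○ ⟩ → code false clear keep ; ⟨ ○ , ● , ○ ⟩ → code true clear keep ; ⟨ ○ , ● , ● ⟩ → code true keep keep ; _ → plain }
    strategy ⟨ ○ , ○ , ○ ⟩ ⟨ ● , ○ , ○ ⟩ singletonA = coded (tagBit ≺ block B ≺ block A)
      λ { ⟨ ● , ○ , ○ ⟩ → code true keep keep ; _ → plain }
    strategy ⟨ ○ , ○ , ○ ⟩ ⟨ ● , ○ , ● ⟩ singletonA = coded (block B ≺ tagBit ≺ block A)
      λ { ⟨ ○ , ○ , ○ ⟩ → code false clear keep ; ⟨ ● , ○ , ○ ⟩ → code true clear keep ; ⟨ ● , ○ , ● ⟩ → code true keep keep ; _ → plain }
    strategy ⟨ ○ , ○ , ○ ⟩ ⟨ ● , ● , ○ ⟩ singletonA = coded (block B ≺ tagBit ≺ block A)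
      λ { ⟨ ○ , ○ , ○ ⟩ → code false clear keep ; ⟨ ● , ○ , ○ ⟩ → code true clear keep ; ⟨ ● , ● , ○ ⟩ → code true keep keep ; _ → plain }
    strategy ⟨ ○ , ○ , ● ⟩ ⟨ ○ , ○ , ○ ⟩ singletonB = coded (tagBit ≺ block A ≺ block B)
      λ { ⟨ ○ , ○ , ● ⟩ → code true keep keep ; _ → plain }
    strategy ⟨ ○ , ○ , ● ⟩ ⟨ ○ , ● , ○ ⟩ bothLarge = grouped
    strategy ⟨ ○ , ○ , ● ⟩ ⟨ ○ , ● , ○ ⟩ singletonA = coded (tagBit ≺ block A ≺ block B)
      λ { ⟨ ○ , ○ , ○ ⟩ → code false clear keep ; ⟨ ○ , ● , ● ⟩ → code true keep keep ; _ → plain }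
    strategy ⟨ ○ , ○ , ● ⟩ ⟨ ○ , ● , ○ ⟩ singletonB = coded (tagBit ≺ block B ≺ block A)
      λ { ⟨ ○ , ○ , ○ ⟩ → code false keep clear ; ⟨ ○ , ● , ● ⟩ → code true keep keep ; _ → plain }
    strategy ⟨ ○ , ○ , ● ⟩ ⟨ ○ , ● , ● ⟩ bothLarge = coded (block B ≺ tagBit ≺ block A)
      λ { ⟨ ○ , ● , ● ⟩ → code true keep keep ; _ → plain }
    strategy ⟨ ○ , ○ , ● ⟩ ⟨ ○ , ● , ● ⟩ singletonA = coded (block B ≺ tagBit ≺ block A)
      λ { ⟨ ○ , ● , ● ⟩ → code true keep keep ; _ → plain }
    strategy ⟨ ○ , ○ , ● ⟩ ⟨ ○ , ● , ● ⟩ singletonB = coded (tagBit ≺ block B ≺ block A)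
      λ { ⟨ ○ , ● , ● ⟩ → code true keep keep ; _ → plain }
    strategy ⟨ ○ , ○ , ● ⟩ ⟨ ● , ○ , ○ ⟩ bothLarge = grouped
    strategy ⟨ ○ , ○ , ● ⟩ ⟨ ● , ○ , ○ ⟩ singletonA = coded (tagBit ≺ block A ≺ block B)
      λ { ⟨ ○ , ○ , ○ ⟩ → code false clear keep ; ⟨ ● , ○ , ● ⟩ → code true keep keep ; _ → plain }
    strategy ⟨ ○ , ○ , ● ⟩ ⟨ ● , ○ , ○ ⟩ singletonB = coded (tagBit ≺ block B ≺ block A)
      λ { ⟨ ○ , ○ , ○ ⟩ → code false keep clear ; ⟨ ● , ○ , ● ⟩ → code true keep keep ; _ → plain }
    strategy ⟨ ○ , ○ , ● ⟩ ⟨ ● , ○ , ● ⟩ bothLarge = coded (block B ≺ tagBit ≺ block A)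
      λ { ⟨ ● , ○ , ● ⟩ → code true keep keep ; _ → plain }
    strategy ⟨ ○ , ○ , ● ⟩ ⟨ ● , ○ , ● ⟩ singletonA = coded (block B ≺ tagBit ≺ block A)
      λ { ⟨ ● , ○ , ● ⟩ → code true keep keep ; _ → plain }
    strategy ⟨ ○ , ○ , ● ⟩ ⟨ ● , ○ , ● ⟩ singletonB = coded (tagBit ≺ block B ≺ block A)
      λ { ⟨ ● , ○ , ● ⟩ → code true keep keep ; _ → plain }
    strategy ⟨ ○ , ○ , ● ⟩ ⟨ ● , ● , ○ ⟩ bothLarge = grouped
    strategy ⟨ ○ , ○ , ● ⟩ ⟨ ● , ● , ○ ⟩ singletonA = coded (tagBit ≺ block A ≺ block B)
      λ { ⟨ ○ , ○ , ○ ⟩ → code false clear keep ; ⟨ ● , ○ , ○ ⟩ → code true clear keep ; ⟨ ● , ● , ● ⟩ → code true fill keep ; _ → plain }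
    strategy ⟨ ○ , ○ , ● ⟩ ⟨ ● , ● , ○ ⟩ singletonB = coded (tagBit ≺ block B ≺ block A)
      λ { ⟨ ○ , ○ , ○ ⟩ → code false keep clear ; ⟨ ○ , ● , ● ⟩ → code false keep fill ; ⟨ ● , ○ , ● ⟩ → code true keep keep ; ⟨ ● , ● , ● ⟩ → code true keep fill ; _ → plain }
    strategy ⟨ ○ , ○ , ● ⟩ ⟨ ● , ● , ● ⟩ singletonB = coded (tagBit ≺ block B ≺ block A)
      λ { ⟨ ○ , ● , ● ⟩ → code false keep fill ; ⟨ ● , ○ , ● ⟩ → code true keep keep ; ⟨ ● , ● , ● ⟩ → code true keep fill ; _ → plain }
    strategy ⟨ ○ , ● , ○ ⟩ ⟨ ○ , ○ , ○ ⟩ singletonB = coded (tagBit ≺ block A ≺ block B)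
      λ { ⟨ ○ , ● , ○ ⟩ → code true keep keep ; _ → plain }
    strategy ⟨ ○ , ● , ○ ⟩ ⟨ ○ , ○ , ● ⟩ bothLarge = grouped
    strategy ⟨ ○ , ● , ○ ⟩ ⟨ ○ , ○ , ● ⟩ singletonA = coded (tagBit ≺ block A ≺ block B)
      λ { ⟨ ○ , ○ , ○ ⟩ → code false clear keep ; ⟨ ○ , ● , ● ⟩ → code true keep keep ; _ → plain }
    strategy ⟨ ○ , ● , ○ ⟩ ⟨ ○ , ○ , ● ⟩ singletonB = coded (tagBit ≺ block B ≺ block A)
      λ { ⟨ ○ , ○ , ○ ⟩ → code false keep clear ; ⟨ ○ , ● , ● ⟩ → code true keep keep ; _ → plain }
    strategy ⟨ ○ , ● , ○ ⟩ ⟨ ○ , ● , ● ⟩ bothLarge = coded (block B ≺ tagBit ≺ block A)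
      λ { ⟨ ○ , ● , ● ⟩ → code true keep keep ; _ → plain }
    strategy ⟨ ○ , ● , ○ ⟩ ⟨ ○ , ● , ● ⟩ singletonA = coded (block B ≺ tagBit ≺ block A)
      λ { ⟨ ○ , ● , ● ⟩ → code true keep keep ; _ → plain }
    strategy ⟨ ○ , ● , ○ ⟩ ⟨ ○ , ● , ● ⟩ singletonB = coded (tagBit ≺ block B ≺ block A)
      λ { ⟨ ○ , ● , ● ⟩ → code true keep keep ; _ → plain }
    strategy ⟨ ○ , ● , ○ ⟩ ⟨ ● , ○ , ○ ⟩ bothLarge = grouped
    strategy ⟨ ○ , ● , ○ ⟩ ⟨ ● , ○ , ○ ⟩ singletonA = coded (tagBit ≺ block A ≺ block B)
      λ { ⟨ ○ , ○ , ○ ⟩ → code false clear keep ; ⟨ ● , ● , ○ ⟩ → code true keep keep ; _ → plain }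
    strategy ⟨ ○ , ● , ○ ⟩ ⟨ ● , ○ , ○ ⟩ singletonB = coded (tagBit ≺ block B ≺ block A)
      λ { ⟨ ○ , ○ , ○ ⟩ → code false keep clear ; ⟨ ● , ● , ○ ⟩ → code true keep keep ; _ → plain }
    strategy ⟨ ○ , ● , ○ ⟩ ⟨ ● , ○ , ● ⟩ bothLarge = grouped
    strategy ⟨ ○ , ● , ○ ⟩ ⟨ ● , ○ , ● ⟩ singletonA = coded (tagBit ≺ block A ≺ block B)
      λ { ⟨ ○ , ○ , ○ ⟩ → code false clear keep ; ⟨ ● , ○ , ○ ⟩ → code true clear keep ; ⟨ ● , ● , ● ⟩ → code true fill keep ; _ → plain }
    strategy ⟨ ○ , ● , ○ ⟩ ⟨ ● , ○ , ● ⟩ singletonB = coded (tagBit ≺ block B ≺ block A)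
      λ { ⟨ ○ , ○ , ○ ⟩ → code false keep clear ; ⟨ ○ , ● , ● ⟩ → code false keep fill ; ⟨ ● , ● , ○ ⟩ → code true keep keep ; ⟨ ● , ● , ● ⟩ → code true keep fill ; _ → plain }
    strategy ⟨ ○ , ● , ○ ⟩ ⟨ ● , ● , ○ ⟩ bothLarge = coded (block B ≺ tagBit ≺ block A)
      λ { ⟨ ● , ● , ○ ⟩ → code true keep keep ; _ → plain }
    strategy ⟨ ○ , ● , ○ ⟩ ⟨ ● , ● , ○ ⟩ singletonA = coded (block B ≺ tagBit ≺ block A)
      λ { ⟨ ● , ● , ○ ⟩ → code true keep keep ; _ → plain }
    strategy ⟨ ○ , ● , ○ ⟩ ⟨ ● , ● , ○ ⟩ singletonB = coded (tagBit ≺ block B ≺ block A)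
      λ { ⟨ ● , ● , ○ ⟩ → code true keep keep ; _ → plain }
    strategy ⟨ ○ , ● , ○ ⟩ ⟨ ● , ● , ● ⟩ singletonB = coded (tagBit ≺ block B ≺ block A)
      λ { ⟨ ○ , ● , ● ⟩ → code false keep fill ; ⟨ ● , ● , ○ ⟩ → code true keep keep ; ⟨ ● , ● , ● ⟩ → code true keep fill ; _ → plain }
    strategy ⟨ ○ , ● , ● ⟩ ⟨ ○ , ○ , ○ ⟩ singletonB = coded (block A ≺ tagBit ≺ block B)
      λ { ⟨ ○ , ○ , ○ ⟩ → code false keep clear ; ⟨ ○ , ● , ○ ⟩ → code true keep clear ; ⟨ ○ , ● , ● ⟩ → code true keep keep ; _ → plain }
    strategy ⟨ ○ , ● , ● ⟩ ⟨ ○ , ○ , ● ⟩ bothLarge = coded (block A ≺ tagBit ≺ block B)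
      λ { ⟨ ○ , ● , ● ⟩ → code true keep keep ; _ → plain }
    strategy ⟨ ○ , ● , ● ⟩ ⟨ ○ , ○ , ● ⟩ singletonA = coded (tagBit ≺ block A ≺ block B)
      λ { ⟨ ○ , ● , ● ⟩ → code true keep keep ; _ → plain }
    strategy ⟨ ○ , ● , ● ⟩ ⟨ ○ , ○ , ● ⟩ singletonB = coded (block A ≺ tagBit ≺ block B)
      λ { ⟨ ○ , ● , ● ⟩ → code true keep keep ; _ → plain }
    strategy ⟨ ○ , ● , ● ⟩ ⟨ ○ , ● , ○ ⟩ bothLarge = coded (block A ≺ tagBit ≺ block B)
      λ { ⟨ ○ , ● , ● ⟩ → code true keep keep ; _ → plain }
    strategy ⟨ ○ , ● , ● ⟩ ⟨ ○ , ● , ○ ⟩ singletonA = coded (tagBit ≺ block A ≺ block B)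
      λ { ⟨ ○ , ● , ● ⟩ → code true keep keep ; _ → plain }
    strategy ⟨ ○ , ● , ● ⟩ ⟨ ○ , ● , ○ ⟩ singletonB = coded (block A ≺ tagBit ≺ block B)
      λ { ⟨ ○ , ● , ● ⟩ → code true keep keep ; _ → plain }
    strategy ⟨ ○ , ● , ● ⟩ ⟨ ● , ○ , ○ ⟩ bothLarge = grouped
    strategy ⟨ ○ , ● , ● ⟩ ⟨ ● , ○ , ○ ⟩ singletonA = coded (tagBit ≺ block A ≺ block B)
      λ { ⟨ ○ , ○ , ○ ⟩ → code false clear keep ; ⟨ ● , ○ , ● ⟩ → code false fill keep ; ⟨ ● , ● , ○ ⟩ → code true keep keep ; ⟨ ● , ● , ● ⟩ → code true fill keep ; _ → plain }
    strategy ⟨ ○ , ● , ● ⟩ ⟨ ● , ○ , ○ ⟩ singletonB = coded (tagBit ≺ block B ≺ block A)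
      λ { ⟨ ○ , ○ , ○ ⟩ → code false keep clear ; ⟨ ○ , ● , ○ ⟩ → code true keep clear ; ⟨ ● , ● , ● ⟩ → code true keep fill ; _ → plain }
    strategy ⟨ ○ , ● , ● ⟩ ⟨ ● , ○ , ● ⟩ bothLarge = grouped
    strategy ⟨ ○ , ● , ● ⟩ ⟨ ● , ○ , ● ⟩ singletonA = coded (tagBit ≺ block A ≺ block B)
      λ { ⟨ ● , ○ , ● ⟩ → code true keep keep ; ⟨ ● , ● , ● ⟩ → code false keep fill ; _ → plain }
    strategy ⟨ ○ , ● , ● ⟩ ⟨ ● , ○ , ● ⟩ singletonB = coded (tagBit ≺ block B ≺ block A)
      λ { ⟨ ○ , ● , ● ⟩ → code true keep keep ; ⟨ ● , ● , ● ⟩ → code false fill keep ; _ → plain }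
    strategy ⟨ ○ , ● , ● ⟩ ⟨ ● , ● , ○ ⟩ bothLarge = grouped
    strategy ⟨ ○ , ● , ● ⟩ ⟨ ● , ● , ○ ⟩ singletonA = coded (tagBit ≺ block A ≺ block B)
      λ { ⟨ ● , ● , ○ ⟩ → code true keep keep ; ⟨ ● , ● , ● ⟩ → code false keep fill ; _ → plain }
    strategy ⟨ ○ , ● , ● ⟩ ⟨ ● , ● , ○ ⟩ singletonB = coded (tagBit ≺ block B ≺ block A)
      λ { ⟨ ○ , ● , ● ⟩ → code true keep keep ; ⟨ ● , ● , ● ⟩ → code false fill keep ; _ → plain }
    strategy ⟨ ○ , ● , ● ⟩ ⟨ ● , ● , ● ⟩ singletonB = coded (tagBit ≺ block A ≺ block B)
      λ { ⟨ ● , ● , ● ⟩ → code false keep fill ; _ → plain }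
    strategy ⟨ ● , ○ , ○ ⟩ ⟨ ○ , ○ , ○ ⟩ singletonB = coded (tagBit ≺ block A ≺ block B)
      λ { ⟨ ● , ○ , ○ ⟩ → code true keep keep ; _ → plain }
    strategy ⟨ ● , ○ , ○ ⟩ ⟨ ○ , ○ , ● ⟩ bothLarge = grouped
    strategy ⟨ ● , ○ , ○ ⟩ ⟨ ○ , ○ , ● ⟩ singletonA = coded (tagBit ≺ block A ≺ block B)
      λ { ⟨ ○ , ○ , ○ ⟩ → code false clear keep ; ⟨ ● , ○ , ● ⟩ → code true keep keep ; _ → plain }
    strategy ⟨ ● , ○ , ○ ⟩ ⟨ ○ , ○ , ● ⟩ singletonB = coded (tagBit ≺ block B ≺ block A)
      λ { ⟨ ○ , ○ , ○ ⟩ → code false keep clear ; ⟨ ● , ○ , ● ⟩ → code true keep keep ; _ → plain }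
    strategy ⟨ ● , ○ , ○ ⟩ ⟨ ○ , ● , ○ ⟩ bothLarge = grouped
    strategy ⟨ ● , ○ , ○ ⟩ ⟨ ○ , ● , ○ ⟩ singletonA = coded (tagBit ≺ block A ≺ block B)
      λ { ⟨ ○ , ○ , ○ ⟩ → code false clear keep ; ⟨ ● , ● , ○ ⟩ → code true keep keep ; _ → plain }
    strategy ⟨ ● , ○ , ○ ⟩ ⟨ ○ , ● , ○ ⟩ singletonB = coded (tagBit ≺ block B ≺ block A)
      λ { ⟨ ○ , ○ , ○ ⟩ → code false keep clear ; ⟨ ● , ● , ○ ⟩ → code true keep keep ; _ → plain }
    strategy ⟨ ● , ○ , ○ ⟩ ⟨ ○ , ● , ● ⟩ bothLarge = grouped
    strategy ⟨ ● , ○ , ○ ⟩ ⟨ ○ , ● , ● ⟩ singletonA = coded (tagBit ≺ block A ≺ block B)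
      λ { ⟨ ○ , ○ , ○ ⟩ → code false clear keep ; ⟨ ○ , ● , ○ ⟩ → code true clear keep ; ⟨ ● , ● , ● ⟩ → code true fill keep ; _ → plain }
    strategy ⟨ ● , ○ , ○ ⟩ ⟨ ○ , ● , ● ⟩ singletonB = coded (tagBit ≺ block B ≺ block A)
      λ { ⟨ ○ , ○ , ○ ⟩ → code false keep clear ; ⟨ ● , ○ , ● ⟩ → code false keep fill ; ⟨ ● , ● , ○ ⟩ → code true keep keep ; ⟨ ● , ● , ● ⟩ → code true keep fill ; _ → plain }
    strategy ⟨ ● , ○ , ○ ⟩ ⟨ ● , ○ , ● ⟩ bothLarge = coded (block B ≺ tagBit ≺ block A)
      λ { ⟨ ● , ○ , ● ⟩ → code true keep keep ; _ → plain }
    strategy ⟨ ● , ○ , ○ ⟩ ⟨ ● , ○ , ● ⟩ singletonA = coded (block B ≺ tagBit ≺ block A)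
      λ { ⟨ ● , ○ , ● ⟩ → code true keep keep ; _ → plain }
    strategy ⟨ ● , ○ , ○ ⟩ ⟨ ● , ○ , ● ⟩ singletonB = coded (tagBit ≺ block B ≺ block A)
      λ { ⟨ ● , ○ , ● ⟩ → code true keep keep ; _ → plain }
    strategy ⟨ ● , ○ , ○ ⟩ ⟨ ● , ● , ○ ⟩ bothLarge = coded (block B ≺ tagBit ≺ block A)
      λ { ⟨ ● , ● , ○ ⟩ → code true keep keep ; _ → plain }
    strategy ⟨ ● , ○ , ○ ⟩ ⟨ ● , ● , ○ ⟩ singletonA = coded (block B ≺ tagBit ≺ block A)
      λ { ⟨ ● , ● , ○ ⟩ → code true keep keep ; _ → plain }
    strategy ⟨ ● , ○ , ○ ⟩ ⟨ ● , ● , ○ ⟩ singletonB = coded (tagBit ≺ block B ≺ block A)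
      λ { ⟨ ● , ● , ○ ⟩ → code true keep keep ; _ → plain }
    strategy ⟨ ● , ○ , ○ ⟩ ⟨ ● , ● , ● ⟩ singletonB = coded (tagBit ≺ block B ≺ block A)
      λ { ⟨ ● , ○ , ● ⟩ → code false keep fill ; ⟨ ● , ● , ○ ⟩ → code true keep keep ; ⟨ ● , ● , ● ⟩ → code true keep fill ; _ → plain }
    strategy ⟨ ● , ○ , ● ⟩ ⟨ ○ , ○ , ○ ⟩ singletonB = coded (block A ≺ tagBit ≺ block B)
      λ { ⟨ ○ , ○ , ○ ⟩ → code false keep clear ; ⟨ ● , ○ , ○ ⟩ → code true keep clear ; ⟨ ● , ○ , ● ⟩ → code true keep keep ; _ → plain }
    strategy ⟨ ● , ○ , ● ⟩ ⟨ ○ , ○ , ● ⟩ bothLarge = coded (block A ≺ tagBit ≺ block B)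
      λ { ⟨ ● , ○ , ● ⟩ → code true keep keep ; _ → plain }
    strategy ⟨ ● , ○ , ● ⟩ ⟨ ○ , ○ , ● ⟩ singletonA = coded (tagBit ≺ block A ≺ block B)
      λ { ⟨ ● , ○ , ● ⟩ → code true keep keep ; _ → plain }
    strategy ⟨ ● , ○ , ● ⟩ ⟨ ○ , ○ , ● ⟩ singletonB = coded (block A ≺ tagBit ≺ block B)
      λ { ⟨ ● , ○ , ● ⟩ → code true keep keep ; _ → plain }
    strategy ⟨ ● , ○ , ● ⟩ ⟨ ○ , ● , ○ ⟩ bothLarge = grouped
    strategy ⟨ ● , ○ , ● ⟩ ⟨ ○ , ● , ○ ⟩ singletonA = coded (tagBit ≺ block A ≺ block B)
      λ { ⟨ ○ , ○ , ○ ⟩ → code false clear keep ; ⟨ ○ , ● , ● ⟩ → code false fill keep ; ⟨ ● , ● , ○ ⟩ → code true keep keep ; ⟨ ● , ● , ● ⟩ → code true fill keep ; _ → plain }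
    strategy ⟨ ● , ○ , ● ⟩ ⟨ ○ , ● , ○ ⟩ singletonB = coded (tagBit ≺ block B ≺ block A)
      λ { ⟨ ○ , ○ , ○ ⟩ → code false keep clear ; ⟨ ● , ○ , ○ ⟩ → code true keep clear ; ⟨ ● , ● , ● ⟩ → code true keep fill ; _ → plain }
    strategy ⟨ ● , ○ , ● ⟩ ⟨ ○ , ● , ● ⟩ bothLarge = grouped
    strategy ⟨ ● , ○ , ● ⟩ ⟨ ○ , ● , ● ⟩ singletonA = coded (tagBit ≺ block A ≺ block B)
      λ { ⟨ ○ , ● , ● ⟩ → code true keep keep ; ⟨ ● , ● , ● ⟩ → code false keep fill ; _ → plain }
    strategy ⟨ ● , ○ , ● ⟩ ⟨ ○ , ● , ● ⟩ singletonB = coded (tagBit ≺ block B ≺ block A)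
      λ { ⟨ ● , ○ , ● ⟩ → code true keep keep ; ⟨ ● , ● , ● ⟩ → code false fill keep ; _ → plain }
    strategy ⟨ ● , ○ , ● ⟩ ⟨ ● , ○ , ○ ⟩ bothLarge = coded (block A ≺ tagBit ≺ block B)
      λ { ⟨ ● , ○ , ● ⟩ → code true keep keep ; _ → plain }
    strategy ⟨ ● , ○ , ● ⟩ ⟨ ● , ○ , ○ ⟩ singletonA = coded (tagBit ≺ block A ≺ block B)
      λ { ⟨ ● , ○ , ● ⟩ → code true keep keep ; _ → plain }
    strategy ⟨ ● , ○ , ● ⟩ ⟨ ● , ○ , ○ ⟩ singletonB = coded (block A ≺ tagBit ≺ block B)
      λ { ⟨ ● , ○ , ● ⟩ → code true keep keep ; _ → plain }
    strategy ⟨ ● , ○ , ● ⟩ ⟨ ● , ● , ○ ⟩ bothLarge = grouped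
    strategy ⟨ ● , ○ , ● ⟩ ⟨ ● , ● , ○ ⟩ singletonA = coded (tagBit ≺ block A ≺ block B)
      λ { ⟨ ● , ● , ○ ⟩ → code true keep keep ; ⟨ ● , ● , ● ⟩ → code false keep fill ; _ → plain }
    strategy ⟨ ● , ○ , ● ⟩ ⟨ ● , ● , ○ ⟩ singletonB = coded (tagBit ≺ block B ≺ block A)
      λ { ⟨ ● , ○ , ● ⟩ → code true keep keep ; ⟨ ● , ● , ● ⟩ → code false fill keep ; _ → plain }
    strategy ⟨ ● , ○ , ● ⟩ ⟨ ● , ● , ● ⟩ singletonB = coded (tagBit ≺ block A ≺ block B)
      λ { ⟨ ● , ● , ● ⟩ → code false keep fill ; _ → plain }
    strategy ⟨ ● , ● , ○ ⟩ ⟨ ○ , ○ , ○ ⟩ singletonB = coded (block A ≺ tagBit ≺ block B)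
      λ { ⟨ ○ , ○ , ○ ⟩ → code false keep clear ; ⟨ ● , ○ , ○ ⟩ → code true keep clear ; ⟨ ● , ● , ○ ⟩ → code true keep keep ; _ → plain }
    strategy ⟨ ● , ● , ○ ⟩ ⟨ ○ , ○ , ● ⟩ bothLarge = grouped
    strategy ⟨ ● , ● , ○ ⟩ ⟨ ○ , ○ , ● ⟩ singletonA = coded (tagBit ≺ block A ≺ block B)
      λ { ⟨ ○ , ○ , ○ ⟩ → code false clear keep ; ⟨ ○ , ● , ● ⟩ → code false fill keep ; ⟨ ● , ○ , ● ⟩ → code true keep keep ; ⟨ ● , ● , ● ⟩ → code true fill keep ; _ → plain }
    strategy ⟨ ● , ● , ○ ⟩ ⟨ ○ , ○ , ● ⟩ singletonB = coded (tagBit ≺ block B ≺ block A)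
      λ { ⟨ ○ , ○ , ○ ⟩ → code false keep clear ; ⟨ ● , ○ , ○ ⟩ → code true keep clear ; ⟨ ● , ● , ● ⟩ → code true keep fill ; _ → plain }
    strategy ⟨ ● , ● , ○ ⟩ ⟨ ○ , ● , ○ ⟩ bothLarge = coded (block A ≺ tagBit ≺ block B)
      λ { ⟨ ● , ● , ○ ⟩ → code true keep keep ; _ → plain }
    strategy ⟨ ● , ● , ○ ⟩ ⟨ ○ , ● , ○ ⟩ singletonA = coded (tagBit ≺ block A ≺ block B)
      λ { ⟨ ● , ● , ○ ⟩ → code true keep keep ; _ → plain }
    strategy ⟨ ● , ● , ○ ⟩ ⟨ ○ , ● , ○ ⟩ singletonB = coded (block A ≺ tagBit ≺ block B)
      λ { ⟨ ● , ● , ○ ⟩ → code true keep keep ; _ → plain }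
    strategy ⟨ ● , ● , ○ ⟩ ⟨ ○ , ● , ● ⟩ bothLarge = grouped
    strategy ⟨ ● , ● , ○ ⟩ ⟨ ○ , ● , ● ⟩ singletonA = coded (tagBit ≺ block A ≺ block B)
      λ { ⟨ ○ , ● , ● ⟩ → code true keep keep ; ⟨ ● , ● , ● ⟩ → code false keep fill ; _ → plain }
    strategy ⟨ ● , ● , ○ ⟩ ⟨ ○ , ● , ● ⟩ singletonB = coded (tagBit ≺ block B ≺ block A)
      λ { ⟨ ● , ● , ○ ⟩ → code true keep keep ; ⟨ ● , ● , ● ⟩ → code false fill keep ; _ → plain }
    strategy ⟨ ● , ● , ○ ⟩ ⟨ ● , ○ , ○ ⟩ bothLarge = coded (block A ≺ tagBit ≺ block B)
      λ { ⟨ ● , ● , ○ ⟩ → code true keep keep ; _ → plain }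
    strategy ⟨ ● , ● , ○ ⟩ ⟨ ● , ○ , ○ ⟩ singletonA = coded (tagBit ≺ block A ≺ block B)
      λ { ⟨ ● , ● , ○ ⟩ → code true keep keep ; _ → plain }
    strategy ⟨ ● , ● , ○ ⟩ ⟨ ● , ○ , ○ ⟩ singletonB = coded (block A ≺ tagBit ≺ block B)
      λ { ⟨ ● , ● , ○ ⟩ → code true keep keep ; _ → plain }
    strategy ⟨ ● , ● , ○ ⟩ ⟨ ● , ○ , ● ⟩ bothLarge = grouped
    strategy ⟨ ● , ● , ○ ⟩ ⟨ ● , ○ , ● ⟩ singletonA = coded (tagBit ≺ block A ≺ block B)
      λ { ⟨ ● , ○ , ● ⟩ → code true keep keep ; ⟨ ● , ● , ● ⟩ → code false keep fill ; _ → plain }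
    strategy ⟨ ● , ● , ○ ⟩ ⟨ ● , ○ , ● ⟩ singletonB = coded (tagBit ≺ block B ≺ block A)
      λ { ⟨ ● , ● , ○ ⟩ → code true keep keep ; ⟨ ● , ● , ● ⟩ → code false fill keep ; _ → plain }
    strategy ⟨ ● , ● , ○ ⟩ ⟨ ● , ● , ● ⟩ singletonB = coded (tagBit ≺ block A ≺ block B)
      λ { ⟨ ● , ● , ● ⟩ → code false keep fill ; _ → plain }
    strategy ⟨ ● , ● , ● ⟩ ⟨ ○ , ○ , ● ⟩ singletonA = coded (tagBit ≺ block A ≺ block B)
      λ { ⟨ ○ , ● , ● ⟩ → code false fill keep ; ⟨ ● , ○ , ● ⟩ → code true keep keep ; ⟨ ● , ● , ● ⟩ → code true fill keep ; _ → plain }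
    strategy ⟨ ● , ● , ● ⟩ ⟨ ○ , ● , ○ ⟩ singletonA = coded (tagBit ≺ block A ≺ block B)
      λ { ⟨ ○ , ● , ● ⟩ → code false fill keep ; ⟨ ● , ● , ○ ⟩ → code true keep keep ; ⟨ ● , ● , ● ⟩ → code true fill keep ; _ → plain }
    strategy ⟨ ● , ● , ● ⟩ ⟨ ○ , ● , ● ⟩ singletonA = coded (tagBit ≺ block A ≺ block B)
      λ { ⟨ ● , ● , ● ⟩ → code false fill keep ; _ → plain }
    strategy ⟨ ● , ● , ● ⟩ ⟨ ● , ○ , ○ ⟩ singletonA = coded (tagBit ≺ block A ≺ block B)
      λ { ⟨ ● , ○ , ● ⟩ → code false fill keep ; ⟨ ● , ● , ○ ⟩ → code true keep keep ; ⟨ ● , ● , ● ⟩ → code true fill keep ; _ → plain }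
    strategy ⟨ ● , ● , ● ⟩ ⟨ ● , ○ , ● ⟩ singletonA = coded (tagBit ≺ block A ≺ block B)
      λ { ⟨ ● , ● , ● ⟩ → code false fill keep ; _ → plain }
    strategy ⟨ ● , ● , ● ⟩ ⟨ ● , ● , ○ ⟩ singletonA = coded (tagBit ≺ block A ≺ block B)
      λ { ⟨ ● , ● , ● ⟩ → code false fill keep ; _ → plain }
    strategy _ _ _ = impossible

  allValidCheck : Bool
  allValidCheck = all (λ X → all (λ Y → not ⌊ X ≟ˣ Y ⌋ ⇒ all (λ r → validCheck r (strategy X Y r) (feasibles (types X Y) r)) regimes) (subsets 3)) (subsets 3)

  opaque
    unfolding feasibles strategy
    allValidCheck≡true : allValidCheck ≡ true
    allValidCheck≡true = refl

  allValid : ∀ X Y → X ≢ Y → ∀ r → Valid (types X Y) r (strategy X Y r)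
  allValid X Y X≢Y r = valid-sound (strategy X Y r)
    (all-sound (λ r → validCheck r (strategy X Y r) (feasibles (types X Y) r))
      (⇒-sound {not ⌊ X ≟ˣ Y ⌋}
        (all-sound (λ Y → not ⌊ X ≟ˣ Y ⌋ ⇒ all (λ r → validCheck r (strategy X Y r) (feasibles (types X Y) r)) regimes)
          (all-sound (λ X → all (λ Y → not ⌊ X ≟ˣ Y ⌋ ⇒ all (λ r → validCheck r (strategy X Y r) (feasibles (types X Y) r)) regimes) (subsets 3))
            (subst T (sym allValidCheck≡true) tt) (∈-subsets X)) (∈-subsets Y))
        (fromWitness (¬? (X ≟ˣ Y)) X≢Y)) (∈-regimes r))

  _≟-side_ : (σ σ' : Side) → Dec (σ ≡ σ')
  A ≟-side A = yes refl
  A ≟-side B = no λ ()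
  B ≟-side A = no λ ()
  B ≟-side B = yes refl

  value : (x y z : ℕ) → Tally → ℕ
  value x y z (tally a b c d) = a + b * x + c * y + d * z

  value-⊕ : ∀ x y z t t' → value x y z (t ⊕ t') ≡ value x y z t + value x y z t'
  value-⊕ x y z (tally a b c d) (tally a' b' c' d') =
    solve 11 (λ a b c d a' b' c' d' x y z → (a :+ a') :+ (b :+ b') :* x :+ (c :+ c') :* y :+ (d :+ d') :* z
               := (a :+ b :* x :+ c :* y :+ d :* z) :+ (a' :+ b' :* x :+ c' :* y :+ d' :* z)) refl a b c d a' b' c' d' x y z
    where open +-*-Solver

  value-mono : ∀ x y z {t t'} → t ≤ᵗ t' → value x y z t ≤ value x y z t'
  value-mono x y z {tally _ _ _ _} {tally _ _ _ _} (a≤a' , b≤b' , c≤c' , d≤d') =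
    +-mono-≤ (+-mono-≤ (+-mono-≤ a≤a' (*-monoˡ-≤ x b≤b')) (*-monoˡ-≤ y c≤c')) (*-monoˡ-≤ z d≤d')

  value-groups : ∀ x y z (g : Subset 3 → Tally) Xs →
    value x y z (foldr (λ X → g X ⊕_) (tally 0 0 0 0) Xs) ≡ sum (map (value x y z ∘ g) Xs)
  value-groups x y z g []       = refl
  value-groups x y z g (X ∷ Xs) = trans (value-⊕ x y z (g X) _) (cong (value x y z (g X) +_) (value-groups x y z g Xs))

  value-onlyA : ∀ x y z → value x y z (tally 0 1 0 0) ≡ x
  value-onlyA = solve 3 (λ x y z → con 0 :+ con 1 :* x :+ con 0 :* y :+ con 0 :* z := x) refl
    where open +-*-Solver

  value-onlyB : ∀ x y z → value x y z (tally 0 0 1 0) ≡ y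
  value-onlyB = solve 3 (λ x y z → con 0 :+ con 0 :* x :+ con 1 :* y :+ con 0 :* z := y) refl
    where open +-*-Solver

  value-both : ∀ x y z → value x y z (tally 0 0 0 1) ≡ z
  value-both = solve 3 (λ x y z → con 0 :+ con 0 :* x :+ con 0 :* y :+ con 1 :* z := z) refl
    where open +-*-Solver

module Counting where
  open import Data.Bool using (Bool; true; false; T; not; _∧_)
  import Data.Bool as Bool
  open import Data.Empty using (⊥; ⊥-elim)
  open import Data.Unit using (tt)
  open import Data.Fin using (Fin; zero; suc; fromℕ<)
  open import Data.Fin.Properties using (any?; all?; ¬∀⟶∃¬)
  open import Data.Fin.Subset using (Subset; _∈_; _∉_; inside; outside)
  open import Data.Nat using (ℕ; zero; suc; _+_; _∸_; _≤_; _<_; s≤s; z≤n; _≟_; s≤s⁻¹)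
  open import Data.Nat.DivMod using (_/_)
  open import Data.Nat.Combinatorics using (_C_)
  open import Data.Nat.Properties using (≤-trans; ≤-refl; ≤-reflexive; +-comm; n≮n; +-mono-≤; +-monoʳ-≤; *-zeroʳ; ∸-monoˡ-≤; module ≤-Reasoning)
  open import Data.Nat.Solver using (module +-*-Solver)
  open import Data.Nat.ListAction using (sum)
  open import Data.List using (List; []; _∷_; map; filter; length)
  open import Data.List.Properties using (map-cong; length-map; filter-none)
  import Data.List.Relation.Unary.Unique.Propositional.Properties as Unique
  open import Data.List.Relation.Unary.All using (All; []; _∷_)
  import Data.List.Relation.Unary.All as All
  open import Data.List.Relation.Unary.AllPairs using (AllPairs; []; _∷_)
  import Data.List as List
  open import Data.List.Properties using (length-tabulate)
  import Data.List.Relation.Unary.AllPairs.Properties as AllPairs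
  import Data.List.Relation.Unary.All.Properties as AllProp
  open import Data.Product using (Σ; _×_; _,_; ∃-syntax; proj₁; proj₂)
  open import Data.Sum using (_⊎_; inj₁; inj₂; [_,_]′)
  open import Data.Vec using (tabulate; lookup)
  open import Data.Vec.Properties using (lookup∘tabulate; tabulate∘lookup; tabulate-cong; lookup⇒[]=; []=⇒lookup)
  open import Data.Vec.Functional using (Vector)
  open import Function using (_∘_; id)
  open import Relation.Binary.PropositionalEquality
  open import Relation.Nullary using (Dec; yes; no; ¬_; _×-dec_; _→-dec_; does)
  open import Relation.Nullary.Decidable using (map′; decidable-stable)
  open import Data.Bool.Properties using (T-≡; T-not-≡; ¬-not; ∧-conicalˡ; not-involutive)
  open import Function.Bundles using (Equivalence)
  open Sperner using (χ)
  open Certificate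

  length-filter-∷ : ∀ {A : Set} {P : A → Set} (P? : ∀ a → Dec (P a)) a xs →
    length (filter P? (a ∷ xs)) ≡ χ (does (P? a)) + length (filter P? xs)
  length-filter-∷ P? a xs with does (P? a)
  ... | true  = refl
  ... | false = refl

  sum-map-+ : ∀ {A : Set} (f g : A → ℕ) xs → sum (map (λ a → f a + g a) xs) ≡ sum (map f xs) + sum (map g xs)
  sum-map-+ f g [] = refl
  sum-map-+ f g (a ∷ xs) = trans (cong (f a + g a +_) (sum-map-+ f g xs)) (+-exchange (f a) (g a) _ _)
    where
    +-exchange : ∀ a b c d → (a + b) + (c + d) ≡ (a + c) + (b + d)
    +-exchange = solve 4 (λ a b c d → (a :+ b) :+ (c :+ d) := (a :+ c) :+ (b :+ d)) refl
      where open +-*-Solver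

  sum-map-mono : ∀ {A : Set} {f g : A → ℕ} xs → (∀ a → f a ≤ g a) → sum (map f xs) ≤ sum (map g xs)
  sum-map-mono [] f≤g = z≤n
  sum-map-mono (a ∷ xs) f≤g = +-mono-≤ (f≤g a) (sum-map-mono xs f≤g)

  subsets₃-once : ∀ Y → sum (map (λ X → χ (does (Y ≟ˣ X))) (subsets 3)) ≡ 1
  subsets₃-once ⟨ ○ , ○ , ○ ⟩ = refl
  subsets₃-once ⟨ ○ , ○ , ● ⟩ = refl
  subsets₃-once ⟨ ○ , ● , ○ ⟩ = refl
  subsets₃-once ⟨ ○ , ● , ● ⟩ = refl
  subsets₃-once ⟨ ● , ○ , ○ ⟩ = refl
  subsets₃-once ⟨ ● , ○ , ● ⟩ = refl
  subsets₃-once ⟨ ● , ● , ○ ⟩ = refl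
  subsets₃-once ⟨ ● , ● , ● ⟩ = refl

  length-by-class : ∀ {A : Set} (f : A → Subset 3) xs →
    length xs ≡ sum (map (λ X → length (filter (λ a → f a ≟ˣ X) xs)) (subsets 3))
  length-by-class f [] = refl
  length-by-class f (a ∷ xs) = begin
    suc (length xs)
      ≡⟨ cong₂ _+_ (sym (subsets₃-once (f a))) (length-by-class f xs) ⟩
    sum (map (λ X → χ (does (f a ≟ˣ X))) (subsets 3)) + sum (map (λ X → length (filter (λ a → f a ≟ˣ X) xs)) (subsets 3))
      ≡⟨ sum-map-+ (λ X → χ (does (f a ≟ˣ X))) (λ X → length (filter (λ a → f a ≟ˣ X) xs)) (subsets 3) ⟨
    sum (map (λ X → χ (does (f a ≟ˣ X)) + length (filter (λ a → f a ≟ˣ X) xs)) (subsets 3))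
      ≡⟨ cong sum (map-cong (λ X → sym (length-filter-∷ (λ a → f a ≟ˣ X) a xs)) (subsets 3)) ⟩
    sum (map (λ X → length (filter (λ a → f a ≟ˣ X) (a ∷ xs))) (subsets 3)) ∎
    where open ≡-Reasoning

  AllPairs-zip : ∀ {A : Set} {P : A → Set} {R S : A → A → Set} → (∀ {a b} → P a → P b → R a b → S a b) →
    ∀ {xs} → All P xs → AllPairs R xs → AllPairs S xs
  AllPairs-zip f [] [] = []
  AllPairs-zip f (pa ∷ pas) (ras ∷ rss) = All.zipWith (λ (pb , r) → f pa pb r) (pas , ras) ∷ AllPairs-zip f pas rss

module Analysis {p q : ℕ} (5≤p : 5 ≤ p) (D : Digraph p q) (orientation : IsOrientation D)
  (diameter : HasDiameterTwo D) (exactlyTwo : ExactlyTwoV2Nonempty D) where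
  open import Data.Bool using (Bool; true; false; T; not; _∧_)
  import Data.Bool as Bool
  open import Data.Empty using (⊥; ⊥-elim)
  open import Data.Unit using (tt)
  open import Data.Fin using (Fin; zero; suc; fromℕ<)
  open import Data.Fin.Properties using (any?; all?; ¬∀⟶∃¬)
  open import Data.Fin.Subset using (Subset; _∈_; _∉_; inside; outside)
  open import Data.Nat using (ℕ; zero; suc; _+_; _∸_; _≤_; _<_; s≤s; z≤n; _≟_; s≤s⁻¹)
  open import Data.Nat.DivMod using (_/_)
  open import Data.Nat.Combinatorics using (_C_)
  open import Data.Nat.Properties using (≤-trans; ≤-refl; ≤-reflexive; +-comm; n≮n; +-mono-≤; +-monoʳ-≤; *-zeroʳ; ∸-monoˡ-≤; module ≤-Reasoning)
  open import Data.Nat.Solver using (module +-*-Solver)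
  open import Data.Nat.ListAction using (sum)
  open import Data.List using (List; []; _∷_; map; filter; length)
  open import Data.List.Properties using (map-cong; length-map; filter-none)
  import Data.List.Relation.Unary.Unique.Propositional.Properties as Unique
  open import Data.List.Relation.Unary.All using (All; []; _∷_)
  import Data.List.Relation.Unary.All as All
  open import Data.List.Relation.Unary.AllPairs using (AllPairs; []; _∷_)
  import Data.List as List
  open import Data.List.Properties using (length-tabulate)
  import Data.List.Relation.Unary.AllPairs.Properties as AllPairs
  import Data.List.Relation.Unary.All.Properties as AllProp
  open import Data.Product using (Σ; _×_; _,_; ∃-syntax; proj₁; proj₂)
  open import Data.Sum using (_⊎_; inj₁; inj₂; [_,_]′)
  open import Data.Vec using (tabulate; lookup)
  open import Data.Vec.Properties using (lookup∘tabulate; tabulate∘lookup; tabulate-cong; lookup⇒[]=; []=⇒lookup)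
  open import Data.Vec.Functional using (Vector)
  open import Function using (_∘_; id)
  open import Relation.Binary.PropositionalEquality
  open import Relation.Nullary using (Dec; yes; no; ¬_; _×-dec_; _→-dec_; does)
  open import Relation.Nullary.Decidable using (map′; decidable-stable)
  open import Data.Bool.Properties using (T-≡; T-not-≡; ¬-not; ∧-conicalˡ; not-involutive)
  open import Function.Bundles using (Equivalence)
  open Sperner
  open Central
  open Certificate
  open Counting

  v₃ : Fin q → Vertex p q
  v₃ w = inj₂ (inj₂ w)

  infix 4 _⟶_
  _⟶_ : Vertex p q → Vertex p q → Set
  u ⟶ v = D u v ≡ true

  true≢false : true ≢ false
  true≢false ()

  no-arc-within : ∀ {u v} → part u ≡ part v → ¬ u ⟶ v
  no-arc-within same arc = true≢false (trans (sym arc) (proj₁ orientation _ _ same))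

  reverse : ∀ {u v} → part u ≢ part v → ¬ u ⟶ v → v ⟶ u
  reverse {u} {v} different ¬arc with proj₂ orientation u v different
  ... | inj₁ (arc , _) = ⊥-elim (¬arc arc)
  ... | inj₂ (_ , arc) = arc

  one-way : ∀ {u v} → part u ≢ part v → u ⟶ v → ¬ v ⟶ u
  one-way {u} {v} different arc back with proj₂ orientation u v different
  ... | inj₁ (_ , no-back) = true≢false (trans (sym back) no-back)
  ... | inj₂ (no-arc , _) = true≢false (trans (sym arc) no-arc)

  two-step : ∀ {u v} → u ≢ v → ¬ u ⟶ v → ∃[ z ] (u ⟶ z × z ⟶ v)
  two-step {u} {v} u≢v ¬arc with proj₁ diameter u v u≢v
  ... | inj₁ arc = ⊥-elim (¬arc arc)
  ... | inj₂ path = path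

  type : Types
  type = types (proj₁ exactlyTwo) (proj₁ (proj₂ exactlyTwo))

  type-A≢B : type A ≢ type B
  type-A≢B = proj₁ (proj₂ (proj₂ exactlyTwo))

  typeOf : Fin p → Subset 3
  typeOf u = tabulate λ i → D (x i) (v₂ u)

  ∈-typeOf : ∀ {i u} → i ∈ typeOf u → x i ⟶ v₂ u
  ∈-typeOf {i} {u} i∈ = trans (sym (lookup∘tabulate (λ i → D (x i) (v₂ u)) i)) ([]=⇒lookup i∈)

  typeOf-∈ : ∀ {i u} → x i ⟶ v₂ u → i ∈ typeOf u
  typeOf-∈ {i} {u} arc = lookup⇒[]= i (typeOf u) (trans (lookup∘tabulate (λ i → D (x i) (v₂ u)) i) arc)

  typeOf-N : ∀ u → InN D (typeOf u) (v₂ u)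
  typeOf-N u i = ∈-typeOf , λ i∉ → reverse (λ ()) (i∉ ∘ typeOf-∈)

  N-typeOf : ∀ {Y u} → InN D Y (v₂ u) → typeOf u ≡ Y
  N-typeOf {Y} {u} inN = trans (tabulate-cong {f = λ i → D (x i) (v₂ u)} pointwise) (tabulate∘lookup Y)
    where
    pointwise : ∀ i → D (x i) (v₂ u) ≡ lookup Y i
    pointwise i with lookup Y i in Ci
    ... | true  = proj₁ (inN i) (lookup⇒[]= i Y Ci)
    ... | false with D (x i) (v₂ u) in arc
    ...   | false = refl
    ...   | true  = ⊥-elim (one-way (λ ()) arc (proj₂ (inN i) (λ i∈Y → true≢false (trans (sym ([]=⇒lookup i∈Y)) Ci))))

  opaque
    side : Fin p → Side
    side u with typeOf u ≟ˣ type A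
    ... | yes _ = A
    ... | no _  = B

    typeOf-side : ∀ u → typeOf u ≡ type (side u)
    typeOf-side u with typeOf u ≟ˣ type A
    ... | yes typeA = typeA
    ... | no ¬typeA with proj₂ (proj₂ (proj₂ (proj₂ (proj₂ exactlyTwo)))) (typeOf u) (u , typeOf-N u)
    ...   | inj₁ typeA = ⊥-elim (¬typeA typeA)
    ...   | inj₂ typeB = typeB

    side-of-type : ∀ {u} σ → typeOf u ≡ type σ → side u ≡ σ
    side-of-type {u} σ typeσ with typeOf u ≟ˣ type A
    side-of-type A _      | yes _     = refl
    side-of-type B typeB  | yes typeA = ⊥-elim (type-A≢B (trans (sym typeA) typeB))
    side-of-type A typeA  | no ¬typeA = ⊥-elim (¬typeA typeA)
    side-of-type B _      | no _      = refl

  x⟶v₂ : ∀ {i u} → i ∈ type (side u) → x i ⟶ v₂ u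
  x⟶v₂ {u = u} i∈ = ∈-typeOf (subst (_ ∈_) (sym (typeOf-side u)) i∈)

  v₂⟶x : ∀ {i u} → i ∉ type (side u) → v₂ u ⟶ x i
  v₂⟶x {u = u} i∉ = reverse (λ ()) (i∉ ∘ subst (_ ∈_) (typeOf-side u) ∘ typeOf-∈)

  x⟶v₂⁻ : ∀ {i u} → x i ⟶ v₂ u → i ∈ type (side u)
  x⟶v₂⁻ {u = u} arc = subst (_ ∈_) (typeOf-side u) (typeOf-∈ arc)

  v₂⟶x⁻ : ∀ {i u} → v₂ u ⟶ x i → i ∉ type (side u)
  v₂⟶x⁻ arc i∈ = one-way (λ ()) arc (x⟶v₂ i∈)

  member : ∀ σ → ∃[ u ] side u ≡ σ
  member A = let u , inN = proj₁ (proj₂ (proj₂ (proj₂ exactlyTwo))) in u , side-of-type A (N-typeOf inN)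
  member B = let u , inN = proj₁ (proj₂ (proj₂ (proj₂ (proj₂ exactlyTwo)))) in u , side-of-type B (N-typeOf inN)

  classOf : Side → Vector Bool p
  classOf σ u = ⌊ side u ≟-side σ ⌋

  ∈-classOf : ∀ {σ u} → side u ≡ σ → classOf σ u ≡ true
  ∈-classOf {σ} {u} refl with side u ≟-side side u
  ... | yes _ = refl
  ... | no ¬refl = ⊥-elim (¬refl refl)

  classOf-∈ : ∀ {σ u} → classOf σ u ≡ true → side u ≡ σ
  classOf-∈ {σ} {u} _ with side u ≟-side σ
  ... | yes same = same

  size : Side → ℕ
  size σ = ∣ classOf σ ∣

  size≥1 : ∀ σ → 1 ≤ size σ
  size≥1 σ = let u , sideu = member σ in ∈⇒∣∣≥1 (classOf σ) u (∈-classOf sideu)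

  size-sum : size A + size B ≡ p
  size-sum = begin
    size A + ∣ classOf B ∣          ≡⟨ cong (size A +_) (∣∣-cong complement) ⟩
    size A + ∣ whole ∖ classOf A ∣   ≡⟨ ∣∣-split {E = classOf A} {U = whole} (λ _ _ → refl) ⟩
    ∣ whole {p} ∣                    ≡⟨ ∣whole∣ p ⟩
    p                               ∎
    where
    open ≡-Reasoning
    complement : ∀ u → classOf B u ≡ (whole ∖ classOf A) u
    complement u with side u
    ... | A = refl
    ... | B = refl

  RegimeFits : Regime → Set
  RegimeFits r = (∀ σ → Single r σ → size σ ≡ 1) × (∀ σ → ¬ Single r σ → 2 ≤ size σ)

  complement-large : ∀ {a b} → a ≡ 1 → a + b ≡ p → 2 ≤ b
  complement-large refl a+b≡p = ≤-trans (s≤s (s≤s z≤n)) (s≤s⁻¹ (subst (5 ≤_) (sym a+b≡p) 5≤p))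

  at-least-two : ∀ {n} → 1 ≤ n → n ≢ 1 → 2 ≤ n
  at-least-two {suc zero}    _ n≢1 = ⊥-elim (n≢1 refl)
  at-least-two {suc (suc n)} _ _   = s≤s (s≤s z≤n)

  opaque
    regimeFits : Σ Regime RegimeFits
    regimeFits with size A ≟ 1 | size B ≟ 1
    ... | yes α≡1 | _ = singletonA , (λ { A _ → α≡1 })
      , λ { A ¬single → ⊥-elim (¬single tt) ; B _ → complement-large α≡1 size-sum }
    ... | no _ | yes β≡1 = singletonB , (λ { B _ → β≡1 })
      , λ { B ¬single → ⊥-elim (¬single tt) ; A _ → complement-large β≡1 (trans (+-comm (size B) (size A)) size-sum) }
    ... | no α≢1 | no β≢1 = bothLarge , (λ _ ())
      , λ { A _ → at-least-two (size≥1 A) α≢1 ; B _ → at-least-two (size≥1 B) β≢1 }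

  regime : Regime
  regime = proj₁ regimeFits

  HasOut HasIn : Side → Fin q → Set
  HasOut σ w = ∃[ u ] (side u ≡ σ × v₃ w ⟶ v₂ u)
  HasIn  σ w = ∃[ u ] (side u ≡ σ × v₂ u ⟶ v₃ w)

  hasOut? : ∀ σ w → Dec (HasOut σ w)
  hasOut? σ w = any? λ u → side u ≟-side σ ×-dec D (v₃ w) (v₂ u) Bool.≟ true

  hasIn? : ∀ σ w → Dec (HasIn σ w)
  hasIn? σ w = any? λ u → side u ≟-side σ ×-dec D (v₂ u) (v₃ w) Bool.≟ true

  opaque
    statusOf : Side → Fin q → Status
    statusOf σ w with hasOut? σ w | hasIn? σ w
    ... | yes _ | yes _ = proper
    ... | yes _ | no _  = full
    ... | no _  | _     = empty

    out⇒≢empty : ∀ {σ w} → HasOut σ w → statusOf σ w ≢ empty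
    out⇒≢empty {σ} {w} out with hasOut? σ w | hasIn? σ w
    ... | yes _   | yes _ = λ ()
    ... | yes _   | no _  = λ ()
    ... | no ¬out | _     = ⊥-elim (¬out out)

    ≢empty⇒out : ∀ {σ w} → statusOf σ w ≢ empty → HasOut σ w
    ≢empty⇒out {σ} {w} ≢empty with hasOut? σ w | hasIn? σ w
    ... | yes out | _ = out
    ... | no _    | _ = ⊥-elim (≢empty refl)

    in⇒≢full : ∀ {σ w} → HasIn σ w → statusOf σ w ≢ full
    in⇒≢full {σ} {w} into with hasOut? σ w | hasIn? σ w
    ... | yes _ | yes _  = λ ()
    ... | yes _ | no ¬in = ⊥-elim (¬in into)
    ... | no _  | _      = λ ()

    ≢full⇒in : ∀ {σ w} → statusOf σ w ≢ full → HasIn σ w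
    ≢full⇒in {σ} {w} ≢full with hasOut? σ w | hasIn? σ w
    ... | _       | yes into = into
    ... | yes _   | no _     = ⊥-elim (≢full refl)
    ... | no ¬out | no ¬in   = let u , sideu = member σ in
      ⊥-elim (¬in (u , sideu , reverse (λ ()) λ w⟶u → ¬out (u , sideu , w⟶u)))

    out∧in⇒proper : ∀ {σ w} → HasOut σ w → HasIn σ w → statusOf σ w ≡ proper
    out∧in⇒proper {σ} {w} out into with hasOut? σ w | hasIn? σ w
    ... | yes _   | yes _  = refl
    ... | yes _   | no ¬in = ⊥-elim (¬in into)
    ... | no ¬out | _      = ⊥-elim (¬out out)

  proper⇒out∧in : ∀ {σ w} → statusOf σ w ≡ proper → HasOut σ w × HasIn σ w
  proper⇒out∧in isProper = ≢empty⇒out (λ isEmpty → proper≢empty (trans (sym isProper) isEmpty))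
                         , ≢full⇒in (λ isFull → proper≢full (trans (sym isProper) isFull))
    where
    proper≢empty : proper ≢ empty
    proper≢empty ()
    proper≢full : proper ≢ full
    proper≢full ()

  side-dichotomy : ∀ σ u → side u ≡ σ ⊎ side u ≡ other σ
  side-dichotomy σ u with side u | σ
  ... | A | A = inj₁ refl
  ... | A | B = inj₂ refl
  ... | B | A = inj₂ refl
  ... | B | B = inj₁ refl

  size-other : ∀ σ → size σ + size (other σ) ≡ p
  size-other A = size-sum
  size-other B = trans (+-comm (size B) (size A)) size-sum

  outOf : Fin q → Subset 3
  outOf w = tabulate λ i → D (v₃ w) (x i)

  ∈-outOf : ∀ {i w} → i ∈ outOf w → v₃ w ⟶ x i
  ∈-outOf {i} {w} i∈ = trans (sym (lookup∘tabulate (λ i → D (v₃ w) (x i)) i)) ([]=⇒lookup i∈)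

  outOf-∈ : ∀ {i w} → v₃ w ⟶ x i → i ∈ outOf w
  outOf-∈ {i} {w} arc = lookup⇒[]= i (outOf w) (trans (lookup∘tabulate (λ i → D (v₃ w) (x i)) i) arc)

  profileOf : Fin q → Profile
  profileOf w = profile (outOf w) (statusOf A w) (statusOf B w)

  status-profileOf : ∀ σ w → status (profileOf w) σ ≡ statusOf σ w
  status-profileOf A w = refl
  status-profileOf B w = refl

  v₃-injective : ∀ {w w'} → w ≢ w' → v₃ w ≢ v₃ w'
  v₃-injective w≢w' refl = w≢w' refl

  feasible : ∀ w → Feasible type regime (profileOf w)
  feasible w = record { from-x = from-x ; to-x = to-x ; back-from = back-from ; back-to = back-to ; sharp = sharp }
    where
    st : ∀ σ → status (profileOf w) σ ≡ statusOf σ w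
    st σ = status-profileOf σ w

    from-x : ∀ i → i ∈ outOf w → ∃[ σ ] (i ∈ type σ × status (profileOf w) σ ≢ full)
    from-x i i∈ with two-step {x i} {v₃ w} (λ ()) (one-way (λ ()) (∈-outOf i∈))
    ... | inj₁ _ , arc , _ = ⊥-elim (no-arc-within refl arc)
    ... | inj₂ (inj₂ _) , _ , arc = ⊥-elim (no-arc-within refl arc)
    ... | inj₂ (inj₁ u) , x⟶u , u⟶w = side u , x⟶v₂⁻ x⟶u , subst (_≢ full) (sym (st (side u))) (in⇒≢full (u , refl , u⟶w))

    to-x : ∀ i → i ∉ outOf w → ∃[ σ ] (i ∉ type σ × status (profileOf w) σ ≢ empty)
    to-x i i∉ with two-step {v₃ w} {x i} (λ ()) (i∉ ∘ outOf-∈)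
    ... | inj₁ _ , _ , arc = ⊥-elim (no-arc-within refl arc)
    ... | inj₂ (inj₂ _) , arc , _ = ⊥-elim (no-arc-within refl arc)
    ... | inj₂ (inj₁ u) , w⟶u , u⟶x = side u , v₂⟶x⁻ u⟶x , subst (_≢ empty) (sym (st (side u))) (out⇒≢empty (u , refl , w⟶u))

    back-from : ∀ σ → status (profileOf w) σ ≢ empty → ∃[ i ] (i ∉ type σ × i ∉ outOf w)
    back-from σ ≢empty with ≢empty⇒out (subst (_≢ empty) (st σ) ≢empty)
    ... | u , refl , w⟶u with two-step {v₂ u} {v₃ w} (λ ()) (one-way (λ ()) w⟶u)
    ...   | inj₂ (inj₁ _) , arc , _ = ⊥-elim (no-arc-within refl arc)
    ...   | inj₂ (inj₂ _) , _ , arc = ⊥-elim (no-arc-within refl arc)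
    ...   | inj₁ i , u⟶x , x⟶w = i , v₂⟶x⁻ u⟶x , one-way (λ ()) x⟶w ∘ ∈-outOf

    back-to : ∀ σ → status (profileOf w) σ ≢ full → ∃[ i ] (i ∈ type σ × i ∈ outOf w)
    back-to σ ≢full with ≢full⇒in (subst (_≢ full) (st σ) ≢full)
    ... | u , refl , u⟶w with two-step {v₃ w} {v₂ u} (λ ()) (one-way (λ ()) u⟶w)
    ...   | inj₂ (inj₁ _) , _ , arc = ⊥-elim (no-arc-within refl arc)
    ...   | inj₂ (inj₂ _) , arc , _ = ⊥-elim (no-arc-within refl arc)
    ...   | inj₁ i , w⟶x , x⟶u = i , x⟶v₂⁻ x⟶u , outOf-∈ w⟶x

    sharp : ∀ σ → Single regime σ → status (profileOf w) σ ≢ proper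
    sharp σ single isProper with proper⇒out∧in (trans (sym (st σ)) isProper)
    ... | (u , sideu , w⟶u) , (u' , sideu' , u'⟶w) = 2≰1 (subst (2 ≤_) (proj₁ (proj₂ regimeFits) σ single)
            (two-points⇒∣∣≥2 (classOf σ) u≢u' (∈-classOf sideu) (∈-classOf sideu')))
      where
      u≢u' : u ≢ u'
      u≢u' refl = one-way (λ ()) w⟶u u'⟶w
      2≰1 : ¬ (2 ≤ 1)
      2≰1 (s≤s ())

  distinguished : ∀ {w w'} → w ≢ w' → outOf w Data.Fin.Subset.⊆ outOf w' → (∀ u → v₃ w ⟶ v₂ u → v₃ w' ⟶ v₂ u) → ⊥
  distinguished {w} {w'} w≢w' out⊆ S⊆ with two-step (v₃-injective w≢w') (no-arc-within refl)
  ... | inj₁ i , w⟶x , x⟶w' = one-way (λ ()) x⟶w' (∈-outOf (out⊆ (outOf-∈ w⟶x)))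
  ... | inj₂ (inj₁ u) , w⟶u , u⟶w' = one-way (λ ()) u⟶w' (S⊆ u w⟶u)
  ... | inj₂ (inj₂ _) , arc , _ = no-arc-within refl arc

  proper-exists : ∀ σ → 2 ≤ size σ → ∃[ w ] statusOf σ w ≡ proper
  proper-exists σ 2≤size with ∣∣≥2⇒two-points (classOf σ) 2≤size
  ... | u , u' , u≢u' , u∈ , u'∈ with two-step {v₂ u} {v₂ u'} (λ { refl → u≢u' refl }) (no-arc-within refl)
  ...   | inj₂ (inj₁ _) , arc , _ = ⊥-elim (no-arc-within refl arc)
  ...   | inj₁ i , u⟶x , x⟶u' = ⊥-elim (v₂⟶x⁻ u⟶x (subst (λ s → i ∈ type s) (trans (classOf-∈ u'∈) (sym (classOf-∈ u∈))) (x⟶v₂⁻ x⟶u')))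
  ...   | inj₂ (inj₂ w) , u⟶w , w⟶u' = w , out∧in⇒proper (u' , classOf-∈ u'∈ , w⟶u') (u , classOf-∈ u∈ , u⟶w)

  module Coded (o : Order) (κ : Subset 3 → Code) (valid : CodingValid type regime o κ) where

    codeOf : Fin q → Vector Bool (suc p)
    codeOf w zero    = tag (κ (outOf w))
    codeOf w (suc u) = apply (mode (κ (outOf w)) (side u)) (D (v₃ w) (v₂ u))

    code-at : ∀ {w u σ m} → side u ≡ σ → mode (κ (outOf w)) σ ≡ m → codeOf w (suc u) ≡ apply m (D (v₃ w) (v₂ u))
    code-at refl refl = refl

    Included : Side → Fin q → Fin q → Set
    Included σ w w' = ∀ u → side u ≡ σ → v₃ w ⟶ v₂ u → v₃ w' ⟶ v₂ u

    included? : ∀ σ w w' → Dec (Included σ w w')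
    included? σ w w' = all? λ u → side u ≟-side σ →-dec D (v₃ w) (v₂ u) Bool.≟ true →-dec D (v₃ w') (v₂ u) Bool.≟ true

    not-included : ∀ {σ w w'} → ¬ Included σ w w' → ∃[ u ] (side u ≡ σ × v₃ w ⟶ v₂ u × ¬ v₃ w' ⟶ v₂ u)
    not-included {σ} {w} {w'} ¬incl with ¬∀⟶∃¬ p _ (λ u → side u ≟-side σ →-dec D (v₃ w) (v₂ u) Bool.≟ true →-dec D (v₃ w') (v₂ u) Bool.≟ true) ¬incl
    ... | u , ¬step with side u ≟-side σ | D (v₃ w) (v₂ u) Bool.≟ true
    ...   | yes sideu | yes w⟶u = u , sideu , w⟶u , λ w'⟶u → ¬step λ _ _ → w'⟶u
    ...   | no ¬sideu | _       = ⊥-elim (¬step λ sideu → ⊥-elim (¬sideu sideu))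
    ...   | _         | no ¬w⟶u = ⊥-elim (¬step λ _ w⟶u → ⊥-elim (¬w⟶u w⟶u))

    inclusion-consistent : ∀ {σ w w'} (incl? : Dec (Included σ w w')) → Inclusion (does incl?) (statusOf σ w) (statusOf σ w')
    inclusion-consistent (yes incl) = (λ ≢empty → let u , sideu , w⟶u = ≢empty⇒out ≢empty in out⇒≢empty (u , sideu , incl u sideu w⟶u))
                   , (λ ≢full → let u , sideu , u⟶w' = ≢full⇒in ≢full in
                        in⇒≢full (u , sideu , reverse (λ ()) λ w⟶u → one-way (λ ()) (incl u sideu w⟶u) u⟶w'))
    inclusion-consistent (no ¬incl) = let u , sideu , w⟶u , ¬w'⟶u = not-included ¬incl in
                     out⇒≢empty (u , sideu , w⟶u) , in⇒≢full (u , sideu , reverse (λ ()) ¬w'⟶u)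

    compatible : ∀ {σ w w'} → codeOf w ⊆ codeOf w' → (incl? : Dec (Included σ w w')) →
      Compatible (mode (κ (outOf w)) σ) (mode (κ (outOf w')) σ) (does incl?) (statusOf σ w) (statusOf σ w')
    compatible {σ} {w} {w'} code⊆ incl? with mode (κ (outOf w)) σ in m | mode (κ (outOf w')) σ in m'
    ... | clear | _     = tt
    ... | keep  | fill  = tt
    ... | fill  | fill  = tt
    ... | keep  | keep  = kept incl?
      where
      kept : (incl? : Dec (Included σ w w')) → T (does incl?)
      kept (yes _) = tt
      kept (no ¬incl) = ¬incl λ u sideu w⟶u → trans (sym (code-at sideu m')) (code⊆ (suc u) (trans (code-at sideu m) w⟶u))
    ... | keep  | clear = decidable-stable (statusOf σ w ≟ˢ empty) λ ≢empty →
      let u , sideu , w⟶u = ≢empty⇒out ≢empty in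
      true≢false (trans (sym (code⊆ (suc u) (trans (code-at sideu m) w⟶u))) (code-at sideu m'))
    ... | fill  | keep  = decidable-stable (statusOf σ w' ≟ˢ full) λ ≢full →
      let u , sideu , u⟶w' = ≢full⇒in ≢full in
      one-way (λ ()) u⟶w' (trans (sym (code-at sideu m')) (code⊆ (suc u) (code-at sideu m)))
    ... | fill  | clear = let u , sideu = member σ in
      true≢false (trans (sym (code⊆ (suc u) (code-at sideu m))) (code-at sideu m'))

    code-antichain : ∀ {w w'} → w ≢ w' → ¬ codeOf w ⊆ codeOf w'
    code-antichain {w} {w'} w≢w' code⊆ with CodingValid.faithful valid (profileOf w) (feasible w) (profileOf w') (feasible w')
      (does (included? A w w')) (does (included? B w w'))
      (λ { A → inclusion-consistent (included? A w w') ; B → inclusion-consistent (included? B w w') })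
      (λ tagged → Equivalence.from T-≡ (code⊆ zero (Equivalence.to T-≡ tagged)))
      (λ { A → compatible code⊆ (included? A w w') ; B → compatible code⊆ (included? B w w') })
    ... | out⊆ , inclA , inclB = distinguished w≢w' out⊆ S⊆
      where
      S⊆ : ∀ u → v₃ w ⟶ v₂ u → v₃ w' ⟶ v₂ u
      S⊆ u w⟶u with side u in sideu
      ... | A = toWitness (included? A w w') inclA u sideu w⟶u
      ... | B = toWitness (included? B w w') inclB u sideu w⟶u

    blockOf : Fin (suc p) → Block
    blockOf zero    = tagBit
    blockOf (suc u) = block (side u)

    rank : Fin (suc p) → ℕ
    rank j = position o (blockOf j)

    meets-sound : ∀ w β → Meets (κ (outOf w)) (profileOf w) β → ∃[ j ] (blockOf j ≡ β × codeOf w j ≡ true)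
    meets-sound w tagBit tagged = zero , refl , Equivalence.to T-≡ tagged
    meets-sound w (block σ) meets with mode (κ (outOf w)) σ in m
    ... | keep = let u , sideu , w⟶u = ≢empty⇒out (subst (_≢ empty) (status-profileOf σ w) meets) in
      suc u , cong block sideu , trans (code-at sideu m) w⟶u
    ... | fill = let u , sideu = member σ in suc u , cong block sideu , code-at sideu m

    misses-sound : ∀ w β → Misses (κ (outOf w)) (profileOf w) β → ∃[ j ] (blockOf j ≡ β × codeOf w j ≡ false)
    misses-sound w tagBit untagged = zero , refl , Equivalence.to T-not-≡ untagged
    misses-sound w (block σ) misses with mode (κ (outOf w)) σ in m
    ... | keep = let u , sideu , u⟶w = ≢full⇒in (subst (_≢ full) (status-profileOf σ w) misses) in
      suc u , cong block sideu , trans (code-at sideu m) (¬-not (one-way (λ ()) u⟶w))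
    ... | clear = let u , sideu = member σ in suc u , cong block sideu , code-at sideu m

    unmet : ∀ {w τ} → ¬ Meets (κ (outOf w)) (profileOf w) (block τ) → ∀ u → side u ≡ τ → codeOf w (suc u) ≡ false
    unmet {w} {τ} ¬meets u sideu with mode (κ (outOf w)) τ in m
    ... | keep  = trans (code-at sideu m) (¬-not λ w⟶u → ¬meets (subst (_≢ empty) (sym (status-profileOf τ w)) (out⇒≢empty (u , sideu , w⟶u))))
    ... | fill  = ⊥-elim (¬meets tt)
    ... | clear = code-at sideu m

    unmissed : ∀ {w τ} → ¬ Misses (κ (outOf w)) (profileOf w) (block τ) → ∀ u → side u ≡ τ → codeOf w (suc u) ≡ true
    unmissed {w} {τ} ¬misses u sideu with mode (κ (outOf w)) τ in m
    ... | keep  = trans (code-at sideu m) (decidable-stable (D (v₃ w) (v₂ u) Bool.≟ true) λ ¬w⟶u →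
                    ¬misses (subst (_≢ full) (sym (status-profileOf τ w)) (in⇒≢full (u , sideu , reverse (λ ()) ¬w⟶u))))
    ... | fill  = code-at sideu m
    ... | clear = ⊥-elim (¬misses tt)

    not-initial⇒not-downset : ∀ w → NotInitial o (κ (outOf w)) (profileOf w) → ¬ Downset rank (codeOf w)
    not-initial⇒not-downset w (β , β' , earlier , misses , meets) down
      with misses-sound w β misses | meets-sound w β' meets
    ... | i , refl , missed | j , refl , met = true≢false (trans (sym (down i j earlier met)) missed)

    lopsided⇒not-middle : ∀ w → Lopsided regime (κ (outOf w)) (profileOf w) → ¬ Middle (suc p) ∣ codeOf w ∣
    lopsided⇒not-middle w (σ , single , inj₁ ¬meets) middle =
      3≰2 (≤-trans (proj₁ (middle-bounds p _ 5≤p middle)) (≤-trans (⊆⇒∣∣≤ code⊆small) ∣small∣≤2))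
      where
      small : Vector Bool (suc p)
      small zero    = true
      small (suc u) = classOf σ u
      code⊆small : codeOf w ⊆ small
      code⊆small zero    _ = refl
      code⊆small (suc u) inCode with side-dichotomy σ u
      ... | inj₁ sideu = ∈-classOf sideu
      ... | inj₂ sideu = ⊥-elim (true≢false (trans (sym inCode) (unmet ¬meets u sideu)))
      ∣small∣≤2 : ∣ small ∣ ≤ 2
      ∣small∣≤2 = s≤s (≤-reflexive (proj₁ (proj₂ regimeFits) σ single))
      3≰2 : ¬ (3 ≤ 2)
      3≰2 (s≤s (s≤s ()))
    lopsided⇒not-middle w (σ , single , inj₂ ¬misses) middle =
      n≮n (suc ∣ codeOf w ∣) (subst (_≤ suc ∣ codeOf w ∣) (+-comm ∣ codeOf w ∣ 2)
        (≤-trans (proj₂ (middle-bounds p _ 5≤p middle)) p≤1+∣code∣))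
      where
      large : Vector Bool (suc p)
      large zero    = false
      large (suc u) = classOf (other σ) u
      large⊆code : large ⊆ codeOf w
      large⊆code (suc u) inOther = unmissed ¬misses u (classOf-∈ inOther)
      p≤1+∣code∣ : p ≤ suc ∣ codeOf w ∣
      p≤1+∣code∣ = subst (_≤ suc ∣ codeOf w ∣) (trans (sym (cong (_+ size (other σ)) (proj₁ (proj₂ regimeFits) σ single))) (size-other σ))
        (s≤s (⊆⇒∣∣≤ large⊆code))

    coded-bound : q < central (suc p)
    coded-bound = subst (_< central (suc p)) (length-tabulate codeOf)
      (sperner-strict rank (List.tabulate codeOf)
        (AllPairs.tabulate⁺ λ w≢w' → code-antichain w≢w' , code-antichain (w≢w' ∘ sym))
        (AllProp.tabulate⁺ λ w down middle →
          [ (λ notInitial → not-initial⇒not-downset w notInitial down) , (λ lopsided → lopsided⇒not-middle w lopsided middle) ]′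
            (CodingValid.nonMiddle valid (profileOf w) (feasible w))))

  module Grouped (valid : GroupingValid type regime) where
    open Groups (feasibles type regime)

    group : Subset 3 → List (Fin q)
    group X = filter (λ w → outOf w ≟ˣ X) (List.allFin q)

    tracked : Subset 3 → Vector Bool p
    tracked X u = not (fixed X (side u))

    restricted : Subset 3 → Fin q → Vector Bool p
    restricted X w u = tracked X u ∧ D (v₃ w) (v₂ u)

    untracked-agree : ∀ {X w w' u} → outOf w ≡ X → outOf w' ≡ X → tracked X u ≡ false → v₃ w ⟶ v₂ u → v₃ w' ⟶ v₂ u
    untracked-agree {X} {w} {w'} {u} outw outw' untracked w⟶u
      with fixed-sound (side u) (Equivalence.from T-≡ (trans (sym (not-involutive _)) (cong not untracked)))
    ... | inj₁ allEmpty = ⊥-elim (out⇒≢empty (u , refl , w⟶u)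
                            (trans (sym (status-profileOf (side u) w)) (allEmpty (profileOf w) (feasible w) outw)))
    ... | inj₂ allFull  = decidable-stable (D (v₃ w') (v₂ u) Bool.≟ true) λ ¬w'⟶u →
      in⇒≢full (u , refl , reverse (λ ()) ¬w'⟶u)
        (trans (sym (status-profileOf (side u) w')) (allFull (profileOf w') (feasible w') outw'))

    group-antichain : ∀ X → Antichain (map (restricted X) (group X))
    group-antichain X = AllPairs.map⁺ (AllPairs-zip incomparable (AllProp.all-filter (λ w → outOf w ≟ˣ X) (List.allFin q))
      (Unique.filter⁺ (λ w → outOf w ≟ˣ X) (Unique.allFin⁺ q)))
      where
      included : ∀ {w w'} → outOf w ≡ X → outOf w' ≡ X → w ≢ w' → ¬ restricted X w ⊆ restricted X w'
      included {w} {w'} outw outw' w≢w' r⊆ = distinguished w≢w' (λ {i} → subst (i ∈_) (trans outw (sym outw'))) S⊆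
        where
        S⊆ : ∀ u → v₃ w ⟶ v₂ u → v₃ w' ⟶ v₂ u
        S⊆ u w⟶u with tracked X u in tr
        ... | true  = trans (sym (cong (_∧ D (v₃ w') (v₂ u)) tr)) (r⊆ u (trans (cong (_∧ D (v₃ w) (v₂ u)) tr) w⟶u))
        ... | false = untracked-agree outw outw' tr w⟶u
      incomparable : ∀ {w w'} → outOf w ≡ X → outOf w' ≡ X → w ≢ w' → Incomparable (restricted X w) (restricted X w')
      incomparable outw outw' w≢w' = included outw outw' w≢w' , included outw' outw (w≢w' ∘ sym)

    group-size : ∀ X → length (group X) ≤ central ∣ tracked X ∣
    group-size X = subst (_≤ central ∣ tracked X ∣) (length-map (restricted X) (group X))
      (sperner (tracked X) (map (restricted X) (group X)) (group-antichain X)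
        (AllProp.map⁺ (All.universal (λ w u → ∧-conicalˡ (tracked X u) _) (group X))))


    cα cβ cp : ℕ
    cα = central (size A)
    cβ = central (size B)
    cp = central p

    ∣nothing∣ : ∣ (λ (_ : Fin p) → false) ∣ ≡ 0
    ∣nothing∣ = trans (∑-const p 0) (*-zeroʳ p)

    group-value : ∀ X → length (group X) ≤ value cα cβ cp (groupTally (absent X) (fixed X A) (fixed X B))
    group-value X with absent X in abs | fixed X A in fA | fixed X B in fB
    ... | true | _ | _ = ≤-reflexive (cong length (filter-none (λ w → outOf w ≟ˣ X)
                           (All.universal (λ w → absent-sound (Equivalence.from T-≡ abs) (profileOf w) (feasible w)) (List.allFin q))))
    ... | false | true | true = subst (λ n → length (group X) ≤ central n) (trans (∣∣-cong untracked) ∣nothing∣) (group-size X)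
      where
      untracked : ∀ u → tracked X u ≡ false
      untracked u with side u
      ... | A = cong not fA
      ... | B = cong not fB
    ... | false | false | true = subst (length (group X) ≤_) (sym (value-onlyA cα cβ cp))
            (subst (λ n → length (group X) ≤ central n) (∣∣-cong trackedA) (group-size X))
      where
      trackedA : ∀ u → tracked X u ≡ classOf A u
      trackedA u with side u
      ... | A = cong not fA
      ... | B = cong not fB
    ... | false | true | false = subst (length (group X) ≤_) (sym (value-onlyB cα cβ cp))
            (subst (λ n → length (group X) ≤ central n) (∣∣-cong trackedB) (group-size X))
      where
      trackedB : ∀ u → tracked X u ≡ classOf B u
      trackedB u with side u
      ... | A = cong not fA
      ... | B = cong not fB
    ... | false | false | false = subst (length (group X) ≤_) (sym (value-both cα cβ cp))
            (subst (λ n → length (group X) ≤ central n) (trans (∣∣-cong trackedAll) (∣whole∣ p)) (group-size X))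
      where
      trackedAll : ∀ u → tracked X u ≡ true
      trackedAll u with side u
      ... | A = cong not fA
      ... | B = cong not fB

    groups-bound : q ≤ value cα cβ cp (groupsTally (feasibles type regime))
    groups-bound = begin
      q                                                    ≡⟨ length-tabulate id ⟨
      length (List.allFin q)                               ≡⟨ length-by-class outOf (List.allFin q) ⟩
      sum (map (λ X → length (group X)) (subsets 3))       ≤⟨ sum-map-mono (subsets 3) group-value ⟩
      sum (map (λ X → value cα cβ cp (groupTally (absent X) (fixed X A) (fixed X B))) (subsets 3))
        ≡⟨ value-groups cα cβ cp (λ X → groupTally (absent X) (fixed X A) (fixed X B)) (subsets 3) ⟨
      value cα cβ cp (groupsTally (feasibles type regime)) ∎
      where open ≤-Reasoning

    room : cα + cβ + 1 ≤ cp × cα + cβ + 1 + cp + 1 ≤ central (suc p)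
    room = subst (λ n → cα + cβ + 1 ≤ central n × cα + cβ + 1 + central n + 1 ≤ central (suc n)) size-sum
      (central-room (size A) (size B) (large A) (large B) (subst (5 ≤_) (sym size-sum) 5≤p))
      where
      large : ∀ σ → 2 ≤ size σ
      large σ = proj₂ (proj₂ regimeFits) σ (subst (λ r → ¬ Single r σ) (sym (GroupingValid.large valid)) λ ())

    grouped-bound : q < central (suc p)
    grouped-bound with GroupingValid.affordable valid
    ... | inj₁ ≤one-each = ≤-trans (s≤s (≤-trans groups-bound (value-mono cα cβ cp {groupsTally (feasibles type regime)} {tally 1 1 1 1} ≤one-each)))
            (subst (_≤ central (suc p)) (one-each cα cβ cp) (proj₂ room))
      where
      one-each : ∀ a b c → a + b + 1 + c + 1 ≡ suc (value a b c (tally 1 1 1 1))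
      one-each = solve 3 (λ a b c → a :+ b :+ con 1 :+ c :+ con 1 := con 1 :+ (con 1 :+ con 1 :* a :+ con 1 :* b :+ con 1 :* c)) refl
        where open +-*-Solver
    ... | inj₂ ≤two-each = ≤-trans (s≤s (≤-trans groups-bound (≤-trans (value-mono cα cβ cp {groupsTally (feasibles type regime)} {tally 2 2 2 0} ≤two-each) two-each)))
            (subst (_≤ central (suc p)) (+-comm _ 1) (proj₂ room))
      where
      two-each : value cα cβ cp (tally 2 2 2 0) ≤ cα + cβ + 1 + cp
      two-each = subst (_≤ cα + cβ + 1 + cp) (sym (doubled cα cβ cp)) (+-monoʳ-≤ (cα + cβ + 1) (proj₁ room))
        where
        doubled : ∀ a b c → value a b c (tally 2 2 2 0) ≡ (a + b + 1) + (a + b + 1)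
        doubled = solve 3 (λ a b c → con 2 :+ con 2 :* a :+ con 2 :* b :+ con 0 :* c := (a :+ b :+ con 1) :+ (a :+ b :+ con 1)) refl
          where open +-*-Solver

  impossible-contradiction : 1 ≤ q → ¬ Impossible type regime
  impossible-contradiction 1≤q (inj₁ noneFeasible) = noneFeasible (profileOf w₀) (feasible w₀)
    where w₀ = fromℕ< 1≤q
  impossible-contradiction 1≤q (inj₂ (σ , notSingle , neverProper))
    with w , isProper ← proper-exists σ (proj₂ (proj₂ regimeFits) σ notSingle) =
    neverProper (profileOf w) (feasible w) (trans (status-profileOf σ w) isProper)

  bound : 1 ≤ q → q < central (suc p)
  bound 1≤q with strategy (type A) (type B) regime | allValid (type A) (type B) type-A≢B regime
  ... | impossible  | valid = ⊥-elim (impossible-contradiction 1≤q valid)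
  ... | coded o κ   | valid = Coded.coded-bound o κ valid
  ... | grouped     | valid = Grouped.grouped-bound valid

open Central using (⌊n/2⌋≡n/2)

theorem4p7 : (p q : ℕ) → 5 ≤ p → p ≤ q → (D : Digraph p q) →
    IsOrientation D → IsStrong D → HasDiameterTwo D → ExactlyTwoV2Nonempty D →
    q ≤ ((p + 1) C ((p + 1) / 2)) ∸ 1
theorem4p7 p q 5≤p p≤q D orientation _ diameter exactlyTwo =
  subst (λ n → q ≤ n C (n / 2) ∸ 1) (+-comm 1 p)
    (subst (λ k → q ≤ suc p C k ∸ 1) (⌊n/2⌋≡n/2 (suc p))
      (∸-monoˡ-≤ 1 (Analysis.bound 5≤p D orientation diameter exactlyTwo (≤-trans (s≤s z≤n) (≤-trans 5≤p p≤q)))))
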